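{- Let $P$ be a bounded, ranked poset of length $n$. Then for all $t\in\mathbb P$, \[\sum_{j=1}^n\mu\big(\widehat{I_{j-1}(P)}\big)\,t^j=-\mu\big((P^\ast\ast T_{t,n})^+\big),\] where $P^\ast$ is the dual of $P$.
   Context: $P^-=P\setminus\{\hat0_P\}$; $C_n$ is the chain $0<\dots<n-1$; $I_j(P)$ is the open principal lower order ideal $\{z\in P^-\ast C_n: z<(\hat1_P,j)\}$. For ranked $P,Q$ the Rees product is $P\ast Q=\{(p,q): r_P(p)\ge r_Q(q)\}$ with $(p_1,q_1)\le(p_2,q_2)$ iff $p_1\le p_2$, $q_1\le q_2$, $r_P(p_2)-r_P(p_1)\ge r_Q(q_2)-r_Q(q_1)$. $T_{t,n}$ is the poset whose Hasse diagram is a complete $t$-ary rooted tree of height $n$ with root at the bottom (every non-leaf has $t$ children, all leaves at distance $n$). $\widehat X$ is $X$ with a new minimum and new maximum adjoined; $X^+$ is $X$ with a new maximum adjoined. For a bounded poset $B$, $\mu(B)=\mu_B(\hat0_B,\hat1_B)$ (Möbius function). -}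

module Defs where

open import Data.Nat as ℕ using (ℕ; zero; suc; _∸_; _+_; _≤_)
open import Data.Nat.Properties using (_≤?_)
open import Data.Integer as ℤ using (ℤ; +_; -_)
open import Data.Fin using (Fin; toℕ)
import Data.Fin.Properties as FinP
open import Data.List using (List; []; _∷_; map; concatMap; length; allFin; upTo; sum)
open import Data.Bool using (Bool; true; false; if_then_else_; _∧_; not)
open import Data.Sum using (_⊎_)
open import Data.Product using (_×_; _,_)
open import Data.Maybe using (Maybe; just; nothing)
import Data.Maybe.Properties as MaybeP
import Data.List.Properties as ListP
import Data.Product.Properties as ProdP
open import Relation.Nullary using (Dec; yes; no; does; ¬_)
open import Relation.Binary using (Decidable; DecidableEquality)
open import Relation.Binary.PropositionalEquality using (_≡_; _≢_; refl; cong)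
open import Data.List.Relation.Binary.Prefix.Heterogeneous using (Prefix)
open import Data.List.Relation.Binary.Prefix.Heterogeneous.Properties using (prefix?)

record BoundedRankedPoset : Set₁ where
  infix 4 _≤P_
  field
    size      : ℕ
    _≤P_      : Fin size → Fin size → Set
    _≤P?_     : Decidable _≤P_
    ≤-refl    : ∀ x → x ≤P x
    ≤-antisym : ∀ {x y} → x ≤P y → y ≤P x → x ≡ y
    ≤-trans   : ∀ {x y z} → x ≤P y → y ≤P z → x ≤P z
    bot       : Fin size
    top       : Fin size
    bot-min   : ∀ x → bot ≤P x
    top-max   : ∀ x → x ≤P top
    rk        : Fin size → ℕ
    rk-bot    : rk bot ≡ 0
    rk-cover  : ∀ x y → x ≤P y → x ≢ y →
                (∀ z → x ≤P z → z ≤P y → z ≡ x ⊎ z ≡ y) →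
                rk y ≡ suc (rk x)
  len : ℕ
  len = rk top

-- Finite ordered sets, given as a carrier type with decidable equality,
-- a decidable order relation and a duplicate-free list `elems` of the
-- elements of the poset (a sub-collection of the carrier).

record FinOrd : Set₁ where
  field
    Carrier : Set
    elems   : List Carrier
    _≼_     : Carrier → Carrier → Set
    _≼?_    : Decidable _≼_
    _≟_     : DecidableEquality Carrier

sumWhere : {A : Set} → (A → Bool) → (A → ℤ) → List A → ℤ
sumWhere p f []       = + 0
sumWhere p f (x ∷ xs) = if p x then f x ℤ.+ sumWhere p f xs else sumWhere p f xs

-- The recursion is on a fuel argument; fuel = number of elements suffices
-- since strict chains in the poset have fewer elements than the poset.
module _ (X : FinOrd) where
  open FinOrd X

  möbiusFuel : ℕ → Carrier → Carrier → ℤ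
  möbiusFuel k x y with does (x ≟ y) | does (x ≼? y)
  ... | true  | _     = + 1
  ... | false | false = + 0
  möbiusFuel zero    x y | false | true = + 0
  möbiusFuel (suc k) x y | false | true =
    - sumWhere (λ z → does (x ≼? z) ∧ does (z ≼? y) ∧ not (does (z ≟ y)))
               (möbiusFuel k x) elems

  möbius : Carrier → Carrier → ℤ
  möbius = möbiusFuel (length elems)

data Hat (A : Set) : Set where
  hbot : Hat A
  mid  : A → Hat A
  htop : Hat A

data HatLe {A : Set} (R : A → A → Set) : Hat A → Hat A → Set where
  bot≤ : ∀ {y} → HatLe R hbot y
  ≤top : ∀ {x} → HatLe R x htop
  mid≤ : ∀ {a b} → R a b → HatLe R (mid a) (mid b)

module _ (X : FinOrd) where
  open FinOrd X

  private
    hle? : Decidable (HatLe _≼_)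
    hle? hbot y = yes bot≤
    hle? x htop = yes ≤top
    hle? (mid a) hbot = no λ ()
    hle? htop hbot = no λ ()
    hle? htop (mid b) = no λ ()
    hle? (mid a) (mid b) with a ≼? b
    ... | yes p = yes (mid≤ p)
    ... | no ¬p = no λ { (mid≤ p) → ¬p p }

    mid-inj : ∀ {a b} → mid {A = Carrier} a ≡ mid b → a ≡ b
    mid-inj refl = refl

    heq : DecidableEquality (Hat Carrier)
    heq hbot hbot = yes refl
    heq htop htop = yes refl
    heq hbot (mid _) = no λ ()
    heq hbot htop = no λ ()
    heq (mid _) hbot = no λ ()
    heq (mid _) htop = no λ ()
    heq htop hbot = no λ ()
    heq htop (mid _) = no λ ()
    heq (mid a) (mid b) with a ≟ b
    ... | yes refl = yes refl
    ... | no ¬p = no λ e → ¬p (mid-inj e)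

  hat : FinOrd
  hat = record
    { Carrier = Hat Carrier
    ; elems   = hbot ∷ htop ∷ map mid elems
    ; _≼_     = HatLe _≼_
    ; _≼?_    = hle?
    ; _≟_     = heq
    }

  μHat : ℤ
  μHat = möbius hat hbot htop

-- X⁺ : adjoin a new maximum (nothing = the new maximum).

data PlusLe {A : Set} (R : A → A → Set) : Maybe A → Maybe A → Set where
  ≤new : ∀ {x} → PlusLe R x nothing
  old≤ : ∀ {a b} → R a b → PlusLe R (just a) (just b)

module _ (X : FinOrd) where
  open FinOrd X

  private
    ple? : Decidable (PlusLe _≼_)
    ple? x nothing = yes ≤new
    ple? nothing (just b) = no λ ()
    ple? (just a) (just b) with a ≼? b
    ... | yes p = yes (old≤ p)
    ... | no ¬p = no λ { (old≤ p) → ¬p p }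

  plus : FinOrd
  plus = record
    { Carrier = Maybe Carrier
    ; elems   = nothing ∷ map just elems
    ; _≼_     = PlusLe _≼_
    ; _≼?_    = ple?
    ; _≟_     = MaybeP.≡-dec _≟_
    }

-- Rees product order, for rank functions rA, rB:
-- (a₁,b₁) ≤ (a₂,b₂) iff a₁ ≤ a₂, b₁ ≤ b₂ and rA a₂ - rA a₁ ≥ rB b₂ - rB b₁
-- (the last written without subtraction: rB b₂ + rA a₁ ≤ rA a₂ + rB b₁).

ReesLe : {A B : Set} (RA : A → A → Set) (RB : B → B → Set)
         (rA : A → ℕ) (rB : B → ℕ) → A × B → A × B → Set
ReesLe RA RB rA rB (a₁ , b₁) (a₂ , b₂) =
  RA a₁ a₂ × RB b₁ b₂ × (rB b₂ + rA a₁ ≤ rA a₂ + rB b₁)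

reesLe? : {A B : Set} {RA : A → A → Set} {RB : B → B → Set} →
          Decidable RA → Decidable RB → (rA : A → ℕ) (rB : B → ℕ) →
          Decidable (ReesLe RA RB rA rB)
reesLe? da db rA rB (a₁ , b₁) (a₂ , b₂)
  with da a₁ a₂ | db b₁ b₂ | (rB b₂ + rA a₁) ≤? (rA a₂ + rB b₁)
... | yes p | yes q | yes r = yes (p , q , r)
... | no ¬p | _     | _     = no λ { (p , _ , _) → ¬p p }
... | yes _ | no ¬q | _     = no λ { (_ , q , _) → ¬q q }
... | yes _ | yes _ | no ¬r = no λ { (_ , _ , r) → ¬r r }

≡-dec× : {A B : Set} → DecidableEquality A → DecidableEquality B →
         DecidableEquality (A × B)
≡-dec× da db = ProdP.≡-dec da db

filterB : {A : Set} → (A → Bool) → List A → List A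
filterB p [] = []
filterB p (x ∷ xs) = if p x then x ∷ filterB p xs else filterB p xs

module Constructions (P : BoundedRankedPoset) where
  open BoundedRankedPoset P

  n : ℕ
  n = len

  -- Rank in P⁻ = P ∖ {0̂}: its minimal elements (the atoms) get rank 0.
  rkMinus : Fin size → ℕ
  rkMinus p = rk p ∸ 1

  -- Chain C_n : 0 < 1 < ... < n-1 (elements Fin n, rank = value).
  ChainLe : Fin n → Fin n → Set
  ChainLe i j = toℕ i ≤ toℕ j

  reesMinusChain : FinOrd
  reesMinusChain = record
    { Carrier = Fin size × Fin n
    ; elems   = filterB (λ { (p , j) → not (does (p FinP.≟ bot)) ∧ does (toℕ j ≤? rkMinus p) })
                        (concatMap (λ p → map (λ j → (p , j)) (allFin n)) (allFin size))
    ; _≼_     = ReesLe _≤P_ ChainLe rkMinus toℕ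
    ; _≼?_    = reesLe? _≤P?_ (λ i j → toℕ i ≤? toℕ j) rkMinus toℕ
    ; _≟_     = ≡-dec× FinP._≟_ FinP._≟_
    }

  idealI : Fin n → FinOrd
  idealI j = record
    { Carrier = Carrier
    ; elems   = filterB (λ z → does (z ≼? (top , j)) ∧ not (does (z ≟ (top , j)))) elems
    ; _≼_     = _≼_
    ; _≼?_    = _≼?_
    ; _≟_     = _≟_
    }
    where open FinOrd reesMinusChain

  -- The tree T_{t,n}: vertices are words over Fin t of length ≤ n
  -- (root = empty word, children of w are w extended by one letter),
  -- ordered by the prefix order; rank = length.
  wordsOfLength : (t : ℕ) → ℕ → List (List (Fin t))
  wordsOfLength t zero    = [] ∷ []
  wordsOfLength t (suc k) = concatMap (λ i → map (i ∷_) (wordsOfLength t k)) (allFin t)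

  treeVertices : (t : ℕ) → List (List (Fin t))
  treeVertices t = concatMap (wordsOfLength t) (upTo (suc n))

  TreeLe : (t : ℕ) → List (Fin t) → List (Fin t) → Set
  TreeLe t = Prefix _≡_

  DualLe : Fin size → Fin size → Set
  DualLe x y = y ≤P x

  rkDual : Fin size → ℕ
  rkDual p = n ∸ rk p

  reesDualTree : (t : ℕ) → FinOrd
  reesDualTree t = record
    { Carrier = Fin size × List (Fin t)
    ; elems   = filterB (λ { (p , w) → does (length w ≤? rkDual p) })
                        (concatMap (λ p → map (λ w → (p , w)) (treeVertices t)) (allFin size))
    ; _≼_     = ReesLe DualLe (TreeLe t) rkDual length
    ; _≼?_    = reesLe? (λ x y → y ≤P? x) (prefix? FinP._≟_) rkDual length
    ; _≟_     = ≡-dec× FinP._≟_ (ListP.≡-dec FinP._≟_)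
    }

  -- μ((P* ∗ T_{t,n})⁺) = μ from its minimum (1̂_P, root) to the new maximum.
  μReesPlus : (t : ℕ) → ℤ
  μReesPlus t = möbius (plus (reesDualTree t)) (just (top , [])) nothing

  -- Σ_{j=1}^{n} μ(Î_{j-1}(P)) t^j   (summing over j-1 ∈ Fin n)
  lhsSum : (t : ℕ) → ℤ
  lhsSum t = sumWhere (λ _ → true)
                      (λ j → μHat (idealI j) ℤ.* ((+ t) ℤ.^ suc (toℕ j)))
                      (allFin n)

module Submission where

-- Write Q = P* ∗ T_{t,n}; its minimum is m₀ = (1̂, root), and every element of
-- Q lies above m₀, so the recursion at the adjoined maximum gives
-- μ(Q⁺) = -Σ_{z ∈ Q} μ_Q(m₀, z).  We group this sum by the word w of
-- z = (p, w).  For each word w, comparing with the recursion for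
-- μ_Q(m₀, (0̂, w)) shows that Σ_p μ_Q(m₀, (p, w)) is minus the sum of
-- μ_Q(m₀, -) over the elements of [m₀, (0̂, w)) whose word is a proper prefix
-- of w.  For w the root this sum is empty.  For |w| = j + 1 these elements,
-- together with m₀ and (0̂, w), form an order-reversed copy of Î_j(P) via
-- (p, i) ↦ (p, w↾(j-i)); transporting μ along this copy and using
-- μ(X) = μ(X*) identifies the sum with -μ(Î_j(P)).  As there are t^{j+1}
-- words of length j + 1, the theorem follows.

open import Defs
open import Data.Nat using (ℕ; _≤_)
open import Data.Integer using (ℤ; -_)
open import Relation.Binary.PropositionalEquality using (_≡_)
open import Data.Nat using (suc)
open import Data.Fin using (Fin; toℕ)
open import Data.List using (length)
open import Data.List.Membership.Propositional using (_∈_)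

module FiniteSums where

  open import Data.Integer using (+_; _+_; _*_)
  import Data.Integer.Properties as ℤP
  open import Algebra.Properties.CommutativeSemigroup ℤP.+-commutativeSemigroup using (interchange)
  open import Data.List using (List; []; _∷_; map; concatMap; _++_)
  open import Data.List.Relation.Unary.Any using (here; there)
  open import Data.List.Relation.Unary.All.Properties using (All¬⇒¬Any)
  open import Data.List.Relation.Unary.Unique.Propositional using (Unique)
  open import Data.List.Relation.Unary.AllPairs using (_∷_)
  open import Data.Bool using (Bool; true; false; if_then_else_; _∧_; _∨_)
  open import Relation.Nullary using (Dec; yes; no; does; ¬_; contradiction)
  open import Relation.Binary.PropositionalEquality using (refl; cong; cong₂; sym; trans; module ≡-Reasoning)

  private variable
    A B : Set

  guard : Bool → ℤ → ℤ
  guard b v = if b then v else + 0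

  sumOver : List A → (A → ℤ) → ℤ
  sumOver []       f = + 0
  sumOver (x ∷ xs) f = f x + sumOver xs f

  sumWhere≡sumOver : (p : A → Bool) (f : A → ℤ) (xs : List A) →
                     sumWhere p f xs ≡ sumOver xs (λ x → guard (p x) (f x))
  sumWhere≡sumOver p f [] = refl
  sumWhere≡sumOver p f (x ∷ xs) with p x
  ... | true  = cong (_+_ (f x)) (sumWhere≡sumOver p f xs)
  ... | false = trans (sumWhere≡sumOver p f xs) (sym (ℤP.+-identityˡ _))

  sumOver-cong-∈ : {xs : List A} {f g : A → ℤ} → (∀ x → x ∈ xs → f x ≡ g x) →
                   sumOver xs f ≡ sumOver xs g
  sumOver-cong-∈ {xs = []}     h = refl
  sumOver-cong-∈ {xs = x ∷ xs} h = cong₂ _+_ (h x (here refl)) (sumOver-cong-∈ (λ y m → h y (there m)))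

  sumOver-cong : (xs : List A) {f g : A → ℤ} → (∀ x → f x ≡ g x) → sumOver xs f ≡ sumOver xs g
  sumOver-cong xs h = sumOver-cong-∈ {xs = xs} (λ x _ → h x)

  sumWhere-map : (p : B → Bool) (f : B → ℤ) (h : A → B) (xs : List A) →
                 sumWhere p f (map h xs) ≡ sumWhere (λ a → p (h a)) (λ a → f (h a)) xs
  sumWhere-map p f h [] = refl
  sumWhere-map p f h (x ∷ xs) with p (h x)
  ... | true  = cong (_+_ (f (h x))) (sumWhere-map p f h xs)
  ... | false = sumWhere-map p f h xs

  sumWhere-cong-test : (p q : A → Bool) (f : A → ℤ) (xs : List A) → (∀ a → p a ≡ q a) →
                       sumWhere p f xs ≡ sumWhere q f xs
  sumWhere-cong-test p q f xs p≗q =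
    trans (sumWhere≡sumOver p f xs)
          (trans (sumOver-cong xs (λ a → cong (λ b → guard b (f a)) (p≗q a))) (sym (sumWhere≡sumOver q f xs)))

  sumOver-++ : (xs ys : List A) (f : A → ℤ) → sumOver (xs ++ ys) f ≡ sumOver xs f + sumOver ys f
  sumOver-++ []       ys f = sym (ℤP.+-identityˡ _)
  sumOver-++ (x ∷ xs) ys f = trans (cong (_+_ (f x)) (sumOver-++ xs ys f)) (sym (ℤP.+-assoc (f x) _ _))

  sumOver-map : (h : A → B) (xs : List A) (f : B → ℤ) →
                sumOver (map h xs) f ≡ sumOver xs (λ a → f (h a))
  sumOver-map h []       f = refl
  sumOver-map h (x ∷ xs) f = cong (_+_ (f (h x))) (sumOver-map h xs f)

  sumOver-concatMap : (h : A → List B) (xs : List A) (f : B → ℤ) →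
                      sumOver (concatMap h xs) f ≡ sumOver xs (λ a → sumOver (h a) f)
  sumOver-concatMap h []       f = refl
  sumOver-concatMap h (x ∷ xs) f =
    trans (sumOver-++ (h x) (concatMap h xs) f) (cong (_+_ (sumOver (h x) f)) (sumOver-concatMap h xs f))

  sumOver-filterB : (p : A → Bool) (xs : List A) (f : A → ℤ) →
                    sumOver (filterB p xs) f ≡ sumOver xs (λ x → guard (p x) (f x))
  sumOver-filterB p []       f = refl
  sumOver-filterB p (x ∷ xs) f with p x
  ... | true  = cong (_+_ (f x)) (sumOver-filterB p xs f)
  ... | false = trans (sumOver-filterB p xs f) (sym (ℤP.+-identityˡ _))

  sumOver-+ : (xs : List A) (f g : A → ℤ) →
              sumOver xs (λ x → f x + g x) ≡ sumOver xs f + sumOver xs g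
  sumOver-+ []       f g = refl
  sumOver-+ (x ∷ xs) f g =
    trans (cong (_+_ (f x + g x)) (sumOver-+ xs f g)) (interchange (f x) (g x) _ _)

  sumOver-zero : (xs : List A) → sumOver xs (λ _ → + 0) ≡ + 0
  sumOver-zero []       = refl
  sumOver-zero (x ∷ xs) = trans (ℤP.+-identityˡ _) (sumOver-zero xs)

  sumOver-*ˡ : (c : ℤ) (xs : List A) (f : A → ℤ) → sumOver xs (λ x → c * f x) ≡ c * sumOver xs f
  sumOver-*ˡ c []       f = sym (ℤP.*-zeroʳ c)
  sumOver-*ˡ c (x ∷ xs) f =
    trans (cong (_+_ (c * f x)) (sumOver-*ˡ c xs f)) (sym (ℤP.*-distribˡ-+ c (f x) _))

  sumOver-swap : (xs : List A) (ys : List B) (F : A → B → ℤ) →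
                 sumOver xs (λ a → sumOver ys (F a)) ≡ sumOver ys (λ b → sumOver xs (λ a → F a b))
  sumOver-swap []       ys F = sym (sumOver-zero ys)
  sumOver-swap (x ∷ xs) ys F =
    trans (cong (_+_ (sumOver ys (F x))) (sumOver-swap xs ys F))
          (sym (sumOver-+ ys (F x) (λ b → sumOver xs (λ a → F a b))))

  sumOver-const : (xs : List A) (c : ℤ) → sumOver xs (λ _ → c) ≡ + length xs * c
  sumOver-const []       c = refl
  sumOver-const (x ∷ xs) c = begin
    c + sumOver xs (λ _ → c)   ≡⟨ cong (_+_ c) (sumOver-const xs c) ⟩
    c + + length xs * c        ≡⟨ cong (_+ + length xs * c) (sym (ℤP.*-identityˡ c)) ⟩
    + 1 * c + + length xs * c  ≡⟨ sym (ℤP.*-distribʳ-+ c (+ 1) (+ length xs)) ⟩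
    + length (x ∷ xs) * c      ∎
    where open ≡-Reasoning

  guard-∧ : ∀ a b v → guard (a ∧ b) v ≡ guard a (guard b v)
  guard-∧ true  b v = refl
  guard-∧ false b v = refl

  guard-∨ : ∀ a b (v : ℤ) → (a ≡ true → b ≡ false) → guard (a ∨ b) v ≡ guard a v + guard b v
  guard-∨ true  b     v excl rewrite excl refl = sym (ℤP.+-identityʳ v)
  guard-∨ false true  v excl = sym (ℤP.+-identityˡ v)
  guard-∨ false false v excl = refl

  guard-implied : ∀ a b (v : ℤ) → (b ≡ true → a ≡ true) → guard a (guard b v) ≡ guard b v
  guard-implied true  b     v h = refl
  guard-implied false false v h = refl
  guard-implied false true  v h with h refl
  ... | ()

  sumOver-guard : (b : Bool) (xs : List A) (f : A → ℤ) →
                  sumOver xs (λ x → guard b (f x)) ≡ guard b (sumOver xs f)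
  sumOver-guard true  xs f = refl
  sumOver-guard false xs f = sumOver-zero xs

  module PointSums {C : Set} (_≟_ : (a b : C) → Dec (a ≡ b)) where

    sumOver-point-∉ : (xs : List C) (y : C) (g : C → ℤ) → ¬ (y ∈ xs) →
                      sumOver xs (λ z → guard (does (z ≟ y)) (g z)) ≡ + 0
    sumOver-point-∉ []       y g _  = refl
    sumOver-point-∉ (x ∷ xs) y g y∉ with x ≟ y
    ... | yes refl = contradiction (here refl) y∉
    ... | no _     = trans (ℤP.+-identityˡ _) (sumOver-point-∉ xs y g (λ m → y∉ (there m)))

    sumOver-point : (xs : List C) (y : C) (g : C → ℤ) → Unique xs → y ∈ xs →
                    sumOver xs (λ z → guard (does (z ≟ y)) (g z)) ≡ g y
    sumOver-point (x ∷ xs) y g (x∉xs ∷ u) m with x ≟ y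
    ... | yes refl = trans (cong (_+_ (g x)) (sumOver-point-∉ xs x g (All¬⇒¬Any x∉xs))) (ℤP.+-identityʳ _)
    ... | no x≢y with m
    ...   | here e   = contradiction (sym e) x≢y
    ...   | there m' = trans (ℤP.+-identityˡ _) (sumOver-point xs y g u m')

module Decisions where

  open import Data.Nat using (_<_; z≤n; s≤s)
  import Data.Nat.Properties as ℕP
  open import Data.List using (List; []; _∷_)
  open import Data.List.Relation.Unary.Any using (here; there)
  open import Data.List.Relation.Unary.All using (All; []; _∷_)
  open import Data.List.Relation.Unary.AllPairs using ([]; _∷_)
  open import Data.List.Relation.Unary.Unique.Propositional using (Unique)
  open import Data.Bool using (Bool; true; false; _∧_)
  open import Data.Product using (_×_; _,_)
  open import Relation.Nullary using (Dec; yes; no; does; ¬_; contradiction)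
  open import Relation.Nullary.Decidable using (dec-true; dec-false)
  open import Relation.Binary.PropositionalEquality using (refl; sym; trans)

  private variable
    A : Set

  witness : {P : Set} (d : Dec P) → does d ≡ true → P
  witness (yes p) _ = p

  refutation : {P : Set} (d : Dec P) → does d ≡ false → ¬ P
  refutation (no ¬p) _ = ¬p

  does-iff : {P Q : Set} (d : Dec P) (e : Dec Q) → (P → Q) → (Q → P) → does d ≡ does e
  does-iff (yes p) e f g = sym (dec-true e (f p))
  does-iff (no ¬p) e f g = sym (dec-false e (λ q → ¬p (g q)))

  ∧-true : ∀ {a b} → a ∧ b ≡ true → a ≡ true × b ≡ true
  ∧-true {true} {true} _ = refl , refl

  filterB-∈ : (p : A → Bool) {xs : List A} {a : A} → a ∈ filterB p xs → p a ≡ true × a ∈ xs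
  filterB-∈ p {x ∷ xs} m with p x in e
  filterB-∈ p {x ∷ xs} (here refl) | true = e , here refl
  filterB-∈ p {x ∷ xs} (there m)   | true = let (q , r) = filterB-∈ p m in q , there r
  filterB-∈ p {x ∷ xs} m           | false = let (q , r) = filterB-∈ p m in q , there r

  filterB-∈⁺ : (p : A → Bool) {xs : List A} {a : A} → p a ≡ true → a ∈ xs → a ∈ filterB p xs
  filterB-∈⁺ p {x ∷ xs} pa (here refl) rewrite pa = here refl
  filterB-∈⁺ p {x ∷ xs} pa (there m) with p x
  ... | true  = there (filterB-∈⁺ p pa m)
  ... | false = filterB-∈⁺ p pa m

  all-filterB : {P : A → Set} (p : A → Bool) {xs : List A} → All P xs → All P (filterB p xs)
  all-filterB p [] = []
  all-filterB p {x ∷ xs} (px ∷ a) with p x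
  ... | true  = px ∷ all-filterB p a
  ... | false = all-filterB p a

  unique-filterB : (p : A → Bool) {xs : List A} → Unique xs → Unique (filterB p xs)
  unique-filterB p [] = []
  unique-filterB p {x ∷ xs} (x∉ ∷ u) with p x
  ... | true  = all-filterB p x∉ ∷ unique-filterB p u
  ... | false = unique-filterB p u

  length-filterB-≤ : (p : A → Bool) (xs : List A) → length (filterB p xs) ≤ length xs
  length-filterB-≤ p [] = z≤n
  length-filterB-≤ p (x ∷ xs) with p x
  ... | true  = s≤s (length-filterB-≤ p xs)
  ... | false = ℕP.m≤n⇒m≤1+n (length-filterB-≤ p xs)

  length-filterB-mono : (p q : A → Bool) (xs : List A) → (∀ z → p z ≡ true → q z ≡ true) →
                        length (filterB p xs) ≤ length (filterB q xs)
  length-filterB-mono p q [] p⇒q = z≤n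
  length-filterB-mono p q (y ∷ ys) p⇒q with p y in ep | q y in eq
  ... | true  | true  = s≤s (length-filterB-mono p q ys p⇒q)
  ... | true  | false = contradiction (trans (sym (p⇒q y ep)) eq) (λ ())
  ... | false | true  = ℕP.m≤n⇒m≤1+n (length-filterB-mono p q ys p⇒q)
  ... | false | false = length-filterB-mono p q ys p⇒q

  length-filterB-< : (p q : A → Bool) (xs : List A) → (∀ z → p z ≡ true → q z ≡ true) →
                     (a : A) → a ∈ xs → p a ≡ false → q a ≡ true →
                     length (filterB p xs) < length (filterB q xs)
  length-filterB-< p q (x ∷ xs) p⇒q a (here refl) pa qa
    rewrite pa | qa = s≤s (length-filterB-mono p q xs p⇒q)
  length-filterB-< p q (x ∷ xs) p⇒q a (there m) pa qa with p x in ep | q x in eq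
  ... | true  | true  = s≤s (length-filterB-< p q xs p⇒q a m pa qa)
  ... | true  | false = contradiction (trans (sym (p⇒q x ep)) eq) (λ ())
  ... | false | true  = ℕP.m≤n⇒m≤1+n (length-filterB-< p q xs p⇒q a m pa qa)
  ... | false | false = length-filterB-< p q xs p⇒q a m pa qa

module MöbiusFunction where

  open import Data.Nat using (zero; _<_; _+_)
  import Data.Nat.Properties as ℕP
  open import Data.Integer using (+_; _*_) renaming (_+_ to _⊕_)
  import Data.Integer.Properties as ℤP
  open import Data.List using (List; []; _∷_)
  open import Data.List.Relation.Unary.Any using (here; there)
  open import Data.List.Relation.Unary.Unique.Propositional using (Unique)
  open import Data.Bool using (Bool; true; false; _∧_; not)
  open import Data.Product using (_×_; _,_)
  open import Relation.Nullary using (Dec; yes; no; does; ¬_; contradiction)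
  open import Relation.Nullary.Decidable using (dec-true; dec-false)
  open import Relation.Binary.Structures using (IsPartialOrder)
  import Relation.Binary.Construct.Flip.EqAndOrd as Flip
  open import Relation.Binary.PropositionalEquality using (refl; cong; cong₂; sym; trans; subst; module ≡-Reasoning)
  open FiniteSums
  open Decisions

  halfOpen : (X : FinOrd) → let open FinOrd X in Carrier → Carrier → Carrier → Bool
  halfOpen X x y z = does (x ≼? z) ∧ does (z ≼? y) ∧ not (does (z ≟ y))
    where open FinOrd X

  halfOpen-elim : (X : FinOrd) → let open FinOrd X in
                  ∀ {x y z} → halfOpen X x y z ≡ true → x ≼ z × z ≼ y × ¬ z ≡ y
  halfOpen-elim X {x} {y} {z} e with FinOrd._≼?_ X x z | FinOrd._≼?_ X z y | FinOrd._≟_ X z y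
  ... | yes a | yes b | no c = a , b , c

  sumWhere-cong : {A : Set} (p : A → Bool) (f g : A → ℤ) (xs : List A) →
                  (∀ z → z ∈ xs → p z ≡ true → f z ≡ g z) → sumWhere p f xs ≡ sumWhere p g xs
  sumWhere-cong p f g [] h = refl
  sumWhere-cong p f g (x ∷ xs) h with p x in eq
  ... | true  = cong₂ _⊕_ (h x (here refl) eq) (sumWhere-cong p f g xs (λ z m → h z (there m)))
  ... | false = sumWhere-cong p f g xs (λ z m → h z (there m))

  module FinitePoset (X : FinOrd) (isPO : IsPartialOrder _≡_ (FinOrd._≼_ X)) where
    open FinOrd X
    open IsPartialOrder isPO using (antisym) renaming (refl to ≼-refl; trans to ≼-trans)

    strictlyBelow : Carrier → Carrier → Bool
    strictlyBelow y z = does (z ≼? y) ∧ not (does (z ≟ y))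

    -- The number of listed elements strictly below y; it strictly increases
    -- along the order, so it bounds the recursion depth of μ(x, y).
    height : Carrier → ℕ
    height y = length (filterB (strictlyBelow y) elems)

    height-bounded : ∀ y → height y ≤ length elems
    height-bounded y = length-filterB-≤ (strictlyBelow y) elems

    height-< : ∀ {a b} → a ∈ elems → a ≼ b → ¬ a ≡ b → height a < height b
    height-< {a} {b} a∈ a≼b a≢b =
      length-filterB-< (strictlyBelow a) (strictlyBelow b) elems below-a⇒below-b a a∈ not-below-self
        (strictlyBelow-intro a≼b a≢b)
      where
      strictlyBelow-intro : ∀ {z y} → z ≼ y → ¬ z ≡ y → strictlyBelow y z ≡ true
      strictlyBelow-intro {z} {y} p q rewrite dec-true (z ≼? y) p | dec-false (z ≟ y) q = refl
      below-a⇒below-b : ∀ z → strictlyBelow a z ≡ true → strictlyBelow b z ≡ true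
      below-a⇒below-b z e with z ≼? a | z ≟ a | e
      ... | yes z≼a | no z≢a | _ =
        strictlyBelow-intro (≼-trans z≼a a≼b) (λ { refl → z≢a (antisym z≼a a≼b) })
      not-below-self : strictlyBelow a a ≡ false
      not-below-self rewrite dec-true (a ≟ a) refl with does (a ≼? a)
      ... | true  = refl
      ... | false = refl

    möbiusFuel-stable : ∀ x → x ∈ elems → ∀ k k' y → height y ≤ k → height y ≤ k' →
                        möbiusFuel X k x y ≡ möbiusFuel X k' x y
    möbiusFuel-stable x x∈ k k' y h h' with x ≟ y | x ≼? y
    ... | yes _ | _    = refl
    ... | no _  | no _ = refl
    möbiusFuel-stable x x∈ zero k' y h h' | no x≢y | yes x≼y =
      contradiction (ℕP.<-≤-trans (height-< x∈ x≼y x≢y) h) ℕP.n≮0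
    möbiusFuel-stable x x∈ (suc k) zero y h h' | no x≢y | yes x≼y =
      contradiction (ℕP.<-≤-trans (height-< x∈ x≼y x≢y) h') ℕP.n≮0
    möbiusFuel-stable x x∈ (suc k) (suc k') y h h' | no x≢y | yes x≼y =
      cong -_ (sumWhere-cong (halfOpen X x y) _ _ elems λ z z∈ e →
        let (_ , z≼y , z≢y) = halfOpen-elim X e
            z<y = height-< z∈ z≼y z≢y in
        möbiusFuel-stable x x∈ k k' z (ℕP.≤-pred (ℕP.≤-trans z<y h)) (ℕP.≤-pred (ℕP.≤-trans z<y h')))

    μ : Carrier → Carrier → ℤ
    μ = möbius X

    μ-fuel : ∀ x → x ∈ elems → ∀ k y → height y ≤ k → möbiusFuel X k x y ≡ μ x y
    μ-fuel x x∈ k y h = möbiusFuel-stable x x∈ k (length elems) y h (height-bounded y)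

    μ-recursion : ∀ x y → x ∈ elems → y ∈ elems → x ≼ y → ¬ x ≡ y →
                  μ x y ≡ - sumWhere (halfOpen X x y) (μ x) elems
    μ-recursion x y x∈ y∈ x≼y x≢y = unfold (length elems) refl
      where
      unfold : ∀ N → N ≡ length elems → möbiusFuel X N x y ≡ - sumWhere (halfOpen X x y) (μ x) elems
      unfold N eq with x ≟ y | x ≼? y
      ... | yes x≡y | _       = contradiction x≡y x≢y
      ... | no _    | no x⋠y  = contradiction x≼y x⋠y
      unfold zero eq | no _ | yes _ =
        contradiction (subst (height x <_) (sym eq) (ℕP.<-≤-trans (height-< x∈ x≼y x≢y) (height-bounded y))) ℕP.n≮0
      unfold (suc N) eq | no _ | yes _ =
        cong -_ (sumWhere-cong (halfOpen X x y) _ _ elems λ z z∈ e →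
          let (_ , z≼y , z≢y) = halfOpen-elim X e in
          μ-fuel x x∈ N z (ℕP.≤-pred (subst (height z <_) (sym eq)
                                       (ℕP.<-≤-trans (height-< z∈ z≼y z≢y) (height-bounded y)))))

    μ-refl : ∀ x → μ x x ≡ + 1
    μ-refl x rewrite dec-true (x ≟ x) refl = refl

    μ-unrelated : ∀ x y → ¬ x ≼ y → μ x y ≡ + 0
    μ-unrelated x y x⋠y rewrite dec-false (x ≟ y) (λ { refl → x⋠y (≼-refl) })
                               | dec-false (x ≼? y) x⋠y = refl

  -- Suppose a region of X
  -- is closed under passing to [x, y), that on it φ preserves equality with x
  -- and comparability with x, and that sums over [x, y) agree with sums over
  -- [φ x, φ y) (i.e. φ maps [x, y) bijectively onto [φ x, φ y)).  Then the
  -- Möbius recursions agree on the region, for every amount of fuel.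
  module Transport (X Y : FinOrd)
    (φ : FinOrd.Carrier X → FinOrd.Carrier Y)
    (x : FinOrd.Carrier X)
    (Region : FinOrd.Carrier X → Set)
    (preserves-≡ : ∀ y → Region y → does (FinOrd._≟_ Y (φ x) (φ y)) ≡ does (FinOrd._≟_ X x y))
    (preserves-≼ : ∀ y → Region y → does (FinOrd._≼?_ Y (φ x) (φ y)) ≡ does (FinOrd._≼?_ X x y))
    (preserves-halfOpen : ∀ y → Region y → FinOrd._≼_ X x y → ¬ x ≡ y → (g : FinOrd.Carrier Y → ℤ) →
                          sumWhere (halfOpen Y (φ x) (φ y)) g (FinOrd.elems Y) ≡
                          sumWhere (halfOpen X x y) (λ z → g (φ z)) (FinOrd.elems X))
    (region-closed : ∀ y z → Region y → z ∈ FinOrd.elems X → halfOpen X x y z ≡ true → Region z)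
    where
    module X = FinOrd X
    module Y = FinOrd Y

    transport : ∀ k y → Region y → möbiusFuel X k x y ≡ möbiusFuel Y k (φ x) (φ y)
    transport k y r with X._≟_ x y | X._≼?_ x y | Y._≟_ (φ x) (φ y) | Y._≼?_ (φ x) (φ y)
                       | preserves-≡ y r | preserves-≼ y r
    ... | yes _ | _     | yes _ | _     | _  | _  = refl
    ... | yes _ | _     | no _  | _     | () | _
    ... | no _  | _     | yes _ | _     | () | _
    ... | no _  | no _  | no _  | no _  | _  | _  = refl
    ... | no _  | yes _ | no _  | no _  | _  | ()
    ... | no _  | no _  | no _  | yes _ | _  | ()
    transport zero    y r | no _   | yes _ | no _ | yes _ | _ | _ = refl
    transport (suc k) y r | no x≢y | yes x≼y | no _ | yes _ | _ | _ =
      cong -_ (sym (trans (preserves-halfOpen y r x≼y x≢y (möbiusFuel Y k (φ x)))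
        (sumWhere-cong (halfOpen X x y) _ _ X.elems λ z z∈ e →
          sym (transport k z (region-closed y z r z∈ e)))))

  dual : FinOrd → FinOrd
  dual X = record
    { Carrier = Carrier ; elems = elems ; _≼_ = λ a b → b ≼ a
    ; _≼?_ = λ a b → b ≼? a ; _≟_ = _≟_ }
    where open FinOrd X

  dual-isPartialOrder : (X : FinOrd) → IsPartialOrder _≡_ (FinOrd._≼_ X) →
                        IsPartialOrder _≡_ (FinOrd._≼_ (dual X))
  dual-isPartialOrder X = Flip.isPartialOrder

  -- Both sides equal the double sum
  --   Σ_{x ≤ z ≤ w ≤ y} μ_X(x, z) μ_{X*}(y, w),
  -- by summing over w first (using Σ_{z ≤ w ≤ y} μ_{X*}(y, w) = [z = y]) or
  -- over z first (using Σ_{x ≤ z ≤ w} μ_X(x, z) = [x = w]).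
  module Duality (X : FinOrd) (isPO : IsPartialOrder _≡_ (FinOrd._≼_ X))
                 (unique : Unique (FinOrd.elems X)) where
    open FinOrd X
    open IsPartialOrder isPO using (antisym) renaming (refl to ≼-refl; trans to ≼-trans)
    open PointSums _≟_
    module L = FinitePoset X isPO
    module R = FinitePoset (dual X) (dual-isPartialOrder X isPO)

    μ* : Carrier → Carrier → ℤ
    μ* a b = R.μ b a

    le eq : Carrier → Carrier → Bool
    le a b = does (a ≼? b)
    eq a b = does (a ≟ b)

    private
      closed-as-halfOpen : ∀ a b z (v : ℤ) → a ≼ b →
        guard (le a z ∧ le z b) v ≡ guard (halfOpen X a b z) v ⊕ guard (eq z b) v
      closed-as-halfOpen a b z v a≼b with z ≟ b
      ... | yes refl rewrite dec-true (a ≼? z) a≼b | dec-true (z ≼? z) ≼-refl = sym (ℤP.+-identityˡ v)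
      ... | no _ with a ≼? z | z ≼? b
      ...   | yes _ | yes _ = sym (ℤP.+-identityʳ v)
      ...   | yes _ | no _  = refl
      ...   | no _  | _     = refl

      closed-as-halfOpen* : ∀ a b z (v : ℤ) → a ≼ b →
        guard (le a z ∧ le z b) v ≡ guard (halfOpen (dual X) b a z) v ⊕ guard (eq z a) v
      closed-as-halfOpen* a b z v a≼b with z ≟ a
      ... | yes refl rewrite dec-true (z ≼? b) a≼b | dec-true (z ≼? z) ≼-refl = sym (ℤP.+-identityˡ v)
      ... | no _ with a ≼? z | z ≼? b
      ...   | yes _ | yes _ = sym (ℤP.+-identityʳ v)
      ...   | yes _ | no _  = refl
      ...   | no _  | yes _ = refl
      ...   | no _  | no _  = refl

      singleton-interval : ∀ a z (v : ℤ) → guard (le a z ∧ le z a) v ≡ guard (eq z a) v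
      singleton-interval a z v with z ≟ a
      ... | yes refl rewrite dec-true (z ≼? z) ≼-refl = refl
      ... | no z≢a with a ≼? z | z ≼? a
      ...   | yes p | yes q = contradiction (antisym q p) z≢a
      ...   | yes _ | no _  = refl
      ...   | no _  | _     = refl

    emptyIntervalSum : ∀ a b → ¬ a ≼ b → (f : Carrier → ℤ) →
                       sumOver elems (λ z → guard (le a z ∧ le z b) (f z)) ≡ guard (eq a b) (+ 1)
    emptyIntervalSum a b a⋠b f rewrite dec-false (a ≟ b) (λ { refl → a⋠b ≼-refl }) =
      trans (sumOver-cong elems outside) (sumOver-zero elems)
      where
      outside : ∀ z → guard (le a z ∧ le z b) (f z) ≡ + 0
      outside z with a ≼? z | z ≼? b
      ... | yes a≼z | yes z≼b = contradiction (≼-trans a≼z z≼b) a⋠b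
      ... | yes _   | no _    = refl
      ... | no _    | _       = refl

    intervalSum : ∀ a b → a ∈ elems → b ∈ elems →
                  sumOver elems (λ z → guard (le a z ∧ le z b) (L.μ a z)) ≡ guard (eq a b) (+ 1)
    intervalSum a b a∈ b∈ with a ≼? b
    ... | no a⋠b = emptyIntervalSum a b a⋠b (L.μ a)
    ... | yes a≼b with a ≟ b
    ... | yes refl = trans (sumOver-cong elems (λ z → singleton-interval a z (L.μ a z)))
                           (trans (sumOver-point elems a (L.μ a) unique a∈) (L.μ-refl a))
    ... | no a≢b = begin
      sumOver elems (λ z → guard (le a z ∧ le z b) (L.μ a z))
        ≡⟨ sumOver-cong elems (λ z → closed-as-halfOpen a b z (L.μ a z) a≼b) ⟩
      sumOver elems (λ z → guard (halfOpen X a b z) (L.μ a z) ⊕ guard (eq z b) (L.μ a z))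
        ≡⟨ sumOver-+ elems _ _ ⟩
      sumOver elems (λ z → guard (halfOpen X a b z) (L.μ a z)) ⊕ sumOver elems (λ z → guard (eq z b) (L.μ a z))
        ≡⟨ cong₂ _⊕_ (sym (sumWhere≡sumOver (halfOpen X a b) (L.μ a) elems))
                     (sumOver-point elems b (L.μ a) unique b∈) ⟩
      S ⊕ L.μ a b
        ≡⟨ cong (_⊕ L.μ a b) (sym (ℤP.neg-involutive S)) ⟩
      - - S ⊕ L.μ a b
        ≡⟨ cong (λ m → - m ⊕ L.μ a b) (sym (L.μ-recursion a b a∈ b∈ a≼b a≢b)) ⟩
      - L.μ a b ⊕ L.μ a b
        ≡⟨ ℤP.+-inverseˡ (L.μ a b) ⟩
      + 0 ∎
      where
      open ≡-Reasoning
      S = sumWhere (halfOpen X a b) (L.μ a) elems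

    intervalSum* : ∀ a b → a ∈ elems → b ∈ elems →
                   sumOver elems (λ z → guard (le a z ∧ le z b) (μ* z b)) ≡ guard (eq a b) (+ 1)
    intervalSum* a b a∈ b∈ with a ≼? b
    ... | no a⋠b = emptyIntervalSum a b a⋠b (λ z → μ* z b)
    ... | yes a≼b with a ≟ b
    ... | yes refl = trans (sumOver-cong elems (λ z → singleton-interval a z (μ* z a)))
                           (trans (sumOver-point elems a (λ z → μ* z a) unique a∈) (R.μ-refl a))
    ... | no a≢b = begin
      sumOver elems (λ z → guard (le a z ∧ le z b) (μ* z b))
        ≡⟨ sumOver-cong elems (λ z → closed-as-halfOpen* a b z (μ* z b) a≼b) ⟩
      sumOver elems (λ z → guard (halfOpen (dual X) b a z) (μ* z b) ⊕ guard (eq z a) (μ* z b))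
        ≡⟨ sumOver-+ elems _ _ ⟩
      sumOver elems (λ z → guard (halfOpen (dual X) b a z) (μ* z b)) ⊕ sumOver elems (λ z → guard (eq z a) (μ* z b))
        ≡⟨ cong₂ _⊕_ (sym (sumWhere≡sumOver (halfOpen (dual X) b a) (R.μ b) elems))
                     (sumOver-point elems a (λ z → μ* z b) unique a∈) ⟩
      S ⊕ μ* a b
        ≡⟨ cong (_⊕ μ* a b) (sym (ℤP.neg-involutive S)) ⟩
      - - S ⊕ μ* a b
        ≡⟨ cong (λ m → - m ⊕ μ* a b) (sym (R.μ-recursion b a b∈ a∈ a≼b (λ e → a≢b (sym e)))) ⟩
      - μ* a b ⊕ μ* a b
        ≡⟨ ℤP.+-inverseˡ (μ* a b) ⟩
      + 0 ∎
      where
      open ≡-Reasoning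
      S = sumWhere (halfOpen (dual X) b a) (R.μ b) elems

    private
      guard-* : ∀ b (u v : ℤ) → guard b (u * v) ≡ u * guard b v
      guard-* true  u v = refl
      guard-* false u v = sym (ℤP.*-zeroʳ u)

      guard-1 : ∀ b (u : ℤ) → u * guard b (+ 1) ≡ guard b u
      guard-1 true  u = ℤP.*-identityʳ u
      guard-1 false u = ℤP.*-zeroʳ u

      guard-reorder : ∀ a b c (u v : ℤ) → guard (a ∧ b ∧ c) (u * v) ≡ guard c (v * guard (a ∧ b) u)
      guard-reorder true  true  true  u v = ℤP.*-comm u v
      guard-reorder true  true  false u v = refl
      guard-reorder true  false true  u v = sym (ℤP.*-zeroʳ v)
      guard-reorder true  false false u v = refl
      guard-reorder false b     true  u v = sym (ℤP.*-zeroʳ v)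
      guard-reorder false b     false u v = refl

    module ChainSum (x y : Carrier) (x∈ : x ∈ elems) (y∈ : y ∈ elems) (x≼y : x ≼ y) where
      open ≡-Reasoning
      term : Carrier → Carrier → ℤ
      term z w = guard (le x z ∧ le z w ∧ le w y) (L.μ x z * μ* w y)

      chainSum : ℤ
      chainSum = sumOver elems (λ z → sumOver elems (term z))

      inner-w : ∀ z → z ∈ elems → sumOver elems (term z) ≡ guard (eq z y) (L.μ x z)
      inner-w z z∈ = begin
        sumOver elems (term z)
          ≡⟨ sumOver-cong elems (λ w → trans (guard-∧ (le x z) (le z w ∧ le w y) _) (cong (guard (le x z)) (guard-* (le z w ∧ le w y) (L.μ x z) (μ* w y)))) ⟩
        sumOver elems (λ w → guard (le x z) (L.μ x z * guard (le z w ∧ le w y) (μ* w y)))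
          ≡⟨ sumOver-guard (le x z) elems _ ⟩
        guard (le x z) (sumOver elems (λ w → L.μ x z * guard (le z w ∧ le w y) (μ* w y)))
          ≡⟨ cong (guard (le x z)) (sumOver-*ˡ (L.μ x z) elems _) ⟩
        guard (le x z) (L.μ x z * sumOver elems (λ w → guard (le z w ∧ le w y) (μ* w y)))
          ≡⟨ cong (λ s → guard (le x z) (L.μ x z * s)) (intervalSum* z y z∈ y∈) ⟩
        guard (le x z) (L.μ x z * guard (eq z y) (+ 1))
          ≡⟨ cong (guard (le x z)) (guard-1 (eq z y) (L.μ x z)) ⟩
        guard (le x z) (guard (eq z y) (L.μ x z))
          ≡⟨ guard-implied (le x z) (eq z y) _ (λ e → dec-true (x ≼? z) (subst (x ≼_) (sym (witness (z ≟ y) e)) x≼y)) ⟩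
        guard (eq z y) (L.μ x z) ∎

      inner-z : ∀ w → w ∈ elems → sumOver elems (λ z → term z w) ≡ guard (eq w x) (μ* w y)
      inner-z w w∈ = begin
        sumOver elems (λ z → term z w)
          ≡⟨ sumOver-cong elems (λ z → guard-reorder (le x z) (le z w) (le w y) (L.μ x z) (μ* w y)) ⟩
        sumOver elems (λ z → guard (le w y) (μ* w y * guard (le x z ∧ le z w) (L.μ x z)))
          ≡⟨ sumOver-guard (le w y) elems _ ⟩
        guard (le w y) (sumOver elems (λ z → μ* w y * guard (le x z ∧ le z w) (L.μ x z)))
          ≡⟨ cong (guard (le w y)) (sumOver-*ˡ (μ* w y) elems _) ⟩
        guard (le w y) (μ* w y * sumOver elems (λ z → guard (le x z ∧ le z w) (L.μ x z)))
          ≡⟨ cong (λ s → guard (le w y) (μ* w y * s)) (intervalSum x w x∈ w∈) ⟩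
        guard (le w y) (μ* w y * guard (eq x w) (+ 1))
          ≡⟨ cong (guard (le w y)) (guard-1 (eq x w) (μ* w y)) ⟩
        guard (le w y) (guard (eq x w) (μ* w y))
          ≡⟨ guard-implied (le w y) (eq x w) _ (λ e → dec-true (w ≼? y) (subst (_≼ y) (witness (x ≟ w) e) x≼y)) ⟩
        guard (eq x w) (μ* w y)
          ≡⟨ cong (λ b → guard b (μ* w y)) (does-iff (x ≟ w) (w ≟ x) sym sym) ⟩
        guard (eq w x) (μ* w y) ∎

      sum-w-first : chainSum ≡ L.μ x y
      sum-w-first = trans (sumOver-cong-∈ inner-w) (sumOver-point elems y (L.μ x) unique y∈)

      sum-z-first : chainSum ≡ μ* x y
      sum-z-first = trans (sumOver-swap elems elems term)
                          (trans (sumOver-cong-∈ inner-z) (sumOver-point elems x (λ w → μ* w y) unique x∈))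

    μ≡μ* : ∀ x y → x ∈ elems → y ∈ elems → L.μ x y ≡ μ* x y
    μ≡μ* x y x∈ y∈ = byComparability (x ≼? y)
      where
      byComparability : Dec (x ≼ y) → L.μ x y ≡ μ* x y
      byComparability (no x⋠y)  = trans (L.μ-unrelated x y x⋠y) (sym (R.μ-unrelated y x x⋠y))
      byComparability (yes x≼y) = trans (sym sum-w-first) sum-z-first
        where open ChainSum x y x∈ y∈ x≼y

module OrderConstructions where

  open import Data.Nat using (_+_)
  import Data.Nat.Properties as ℕP
  open import Data.Nat.Tactic.RingSolver using (solve-∀)
  open import Data.List using (List; []; _∷_; map; concatMap; cartesianProduct; _++_)
  open import Data.List.Relation.Unary.All using (All; []; _∷_)
  open import Data.List.Relation.Unary.AllPairs using (_∷_)
  open import Data.List.Relation.Unary.Unique.Propositional using (Unique)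
  import Data.List.Relation.Unary.Unique.Propositional.Properties as Unique
  open import Data.List.Relation.Binary.Prefix.Heterogeneous using (Prefix; []; _∷_)
  import Data.List.Relation.Binary.Prefix.Heterogeneous.Properties as Prefix
  open import Data.List.Relation.Binary.Pointwise using (Pointwise-≡⇒≡)
  open import Data.Product using (_,_)
  open import Data.Maybe using (just)
  open import Relation.Nullary using (does; ¬_)
  open import Relation.Binary.Structures using (IsPartialOrder)
  open import Relation.Binary.PropositionalEquality using (refl; cong; cong₂; trans; isEquivalence)
  open Decisions

  private variable
    A B : Set

  mkPartialOrder : {R : A → A → Set} → (∀ x → R x x) → (∀ {x y z} → R x y → R y z → R x z) →
                   (∀ {x y} → R x y → R y x → x ≡ y) → IsPartialOrder _≡_ R
  mkPartialOrder r t a = record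
    { isPreorder = record { isEquivalence = isEquivalence ; reflexive = λ { refl → r _ } ; trans = t }
    ; antisym = a }

  prefix-isPartialOrder : IsPartialOrder {A = List A} _≡_ (Prefix _≡_)
  prefix-isPartialOrder = mkPartialOrder prefix-refl (Prefix.trans trans)
                                         (λ p q → Pointwise-≡⇒≡ (Prefix.antisym (λ e _ → e) p q))
    where
    prefix-refl : (xs : List _) → Prefix _≡_ xs xs
    prefix-refl []       = []
    prefix-refl (x ∷ xs) = refl ∷ prefix-refl xs

  -- The Rees product of two ranked partial orders is a partial order; the
  -- rank condition is transitive because rank differences add up.
  rees-isPartialOrder : {RA : A → A → Set} {RB : B → B → Set} {rA : A → ℕ} {rB : B → ℕ} →
    IsPartialOrder _≡_ RA → IsPartialOrder _≡_ RB → IsPartialOrder _≡_ (ReesLe RA RB rA rB)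
  rees-isPartialOrder {RA = RA} {RB} {rA} {rB} poA poB = mkPartialOrder
    (λ (a , b) → A.refl , B.refl , ℕP.≤-reflexive (ℕP.+-comm (rB b) (rA a)))
    rees-trans
    (λ (p , q , _) (p' , q' , _) → cong₂ _,_ (A.antisym p p') (B.antisym q q'))
    where
    module A = IsPartialOrder poA
    module B = IsPartialOrder poB
    open ℕP.≤-Reasoning
    shuffle₁ : ∀ a b c d → a + b + (c + d) ≡ (a + d) + (c + b)
    shuffle₁ = solve-∀
    shuffle₂ : ∀ a b c d → (a + b) + (c + d) ≡ a + d + (b + c)
    shuffle₂ = solve-∀
    rees-trans : ∀ {x y z} → ReesLe RA RB rA rB x y → ReesLe RA RB rA rB y z → ReesLe RA RB rA rB x z
    rees-trans {a₁ , b₁} {a₂ , b₂} {a₃ , b₃} (p , q , r) (p' , q' , r') =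
      A.trans p p' , B.trans q q' , ℕP.+-cancelʳ-≤ (rB b₂ + rA a₂) _ _ (begin
        rB b₃ + rA a₁ + (rB b₂ + rA a₂)   ≡⟨ shuffle₁ (rB b₃) (rA a₁) (rB b₂) (rA a₂) ⟩
        (rB b₃ + rA a₂) + (rB b₂ + rA a₁) ≤⟨ ℕP.+-mono-≤ r' r ⟩
        (rA a₃ + rB b₂) + (rA a₂ + rB b₁) ≡⟨ shuffle₂ (rA a₃) (rB b₂) (rA a₂) (rB b₁) ⟩
        rA a₃ + rB b₁ + (rB b₂ + rA a₂)   ∎)

  hat-isPartialOrder : {R : A → A → Set} → IsPartialOrder _≡_ R → IsPartialOrder _≡_ (HatLe R)
  hat-isPartialOrder {R = R} po = mkPartialOrder hat-refl hat-trans hat-antisym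
    where
    module R = IsPartialOrder po
    hat-refl : ∀ x → HatLe R x x
    hat-refl hbot    = bot≤
    hat-refl (mid a) = mid≤ R.refl
    hat-refl htop    = ≤top
    hat-trans : ∀ {x y z} → HatLe R x y → HatLe R y z → HatLe R x z
    hat-trans bot≤     q        = bot≤
    hat-trans ≤top     ≤top     = ≤top
    hat-trans (mid≤ p) ≤top     = ≤top
    hat-trans (mid≤ p) (mid≤ q) = mid≤ (R.trans p q)
    hat-antisym : ∀ {x y} → HatLe R x y → HatLe R y x → x ≡ y
    hat-antisym bot≤     bot≤     = refl
    hat-antisym ≤top     ≤top     = refl
    hat-antisym (mid≤ p) (mid≤ q) = cong mid (R.antisym p q)

  mid-injective : ∀ {a b : A} → mid a ≡ mid b → a ≡ b
  mid-injective refl = refl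

  hat-unique : (X : FinOrd) → Unique (FinOrd.elems X) → Unique (FinOrd.elems (hat X))
  hat-unique X u = ((λ ()) ∷ notMid (FinOrd.elems X) (λ ())) ∷ notMid (FinOrd.elems X) (λ ())
                   ∷ Unique.map⁺ mid-injective u
    where
    notMid : ∀ {e} (xs : List (FinOrd.Carrier X)) → (∀ {a} → ¬ e ≡ mid a) → All (λ z → ¬ e ≡ z) (map mid xs)
    notMid []       ne = []
    notMid (x ∷ xs) ne = ne ∷ notMid xs ne

  pairs≡cartesianProduct : (xs : List A) (ys : List B) →
                           concatMap (λ a → map (a ,_) ys) xs ≡ cartesianProduct xs ys
  pairs≡cartesianProduct []       ys = refl
  pairs≡cartesianProduct (x ∷ xs) ys = cong (map (x ,_) ys ++_) (pairs≡cartesianProduct xs ys)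

  pairs-unique : {xs : List A} {ys : List B} → Unique xs → Unique ys →
                 Unique (concatMap (λ a → map (a ,_) ys) xs)
  pairs-unique {xs = xs} {ys} ux uy rewrite pairs≡cartesianProduct xs ys = Unique.cartesianProduct⁺ ux uy

  module PlusEmbedding (X : FinOrd) where
    open FinOrd X
    module X⁺ = FinOrd (plus X)

    plus-≼-just : ∀ a b → does (X⁺._≼?_ (just a) (just b)) ≡ does (a ≼? b)
    plus-≼-just a b = does-iff (X⁺._≼?_ (just a) (just b)) (a ≼? b) (λ { (old≤ p) → p }) old≤

    plus-≟-just : ∀ a b → does (X⁺._≟_ (just a) (just b)) ≡ does (a ≟ b)
    plus-≟-just a b = does-iff (X⁺._≟_ (just a) (just b)) (a ≟ b) (λ { refl → refl }) (cong just)

module RankedPosets (P : BoundedRankedPoset) where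

  open import Data.Nat using (zero; _<_)
  import Data.Nat.Properties as ℕP
  import Data.Fin.Properties as FinP
  open import Data.List using (allFin)
  open import Data.List.Membership.Propositional.Properties using (∈-allFin)
  open import Data.Bool using (Bool; true; false; _∧_)
  open import Data.Sum using (_⊎_; inj₁; inj₂)
  open import Data.Product using (_×_; _,_)
  open import Relation.Nullary using (yes; no; does; ¬_; contradiction)
  open import Relation.Nullary.Decidable using (dec-true; dec-false; _×-dec_; ¬?)
  open import Relation.Binary.Structures using (IsPartialOrder)
  open import Relation.Binary.PropositionalEquality using (refl; sym; trans; subst)
  open BoundedRankedPoset P
  open Decisions

  isPartialOrder : IsPartialOrder _≡_ _≤P_
  isPartialOrder = OrderConstructions.mkPartialOrder ≤-refl ≤-trans ≤-antisym

  private
    between : Fin size → Fin size → Fin size → Bool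
    between x y z = does (x ≤P? z) ∧ does (z ≤P? y)

    between-intro : ∀ {x y z} → x ≤P z → z ≤P y → between x y z ≡ true
    between-intro {x} {y} {z} a b rewrite dec-true (x ≤P? z) a | dec-true (z ≤P? y) b = refl

    between-elim : ∀ {x y z} → between x y z ≡ true → x ≤P z × z ≤P y
    between-elim {x} {y} {z} e with x ≤P? z | z ≤P? y
    ... | yes a | yes b = a , b

    between-false₁ : ∀ {x y z} → ¬ x ≤P z → between x y z ≡ false
    between-false₁ {x} {y} {z} x≰z rewrite dec-false (x ≤P? z) x≰z = refl

    between-false₂ : ∀ {x y z} → ¬ z ≤P y → between x y z ≡ false
    between-false₂ {x} {y} {z} z≰y rewrite dec-false (z ≤P? y) z≰y with does (x ≤P? z)
    ... | true  = refl
    ... | false = refl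

    -- Size of the closed interval [x, y]: the induction measure below.
    intervalSize : Fin size → Fin size → ℕ
    intervalSize x y = length (filterB (between x y) (allFin size))

  -- If x < y, either y covers x (rank goes up by one) or some z lies strictly
  -- between, splitting [x, y] into two strictly smaller intervals.
  rk-< : ∀ {x y} → x ≤P y → ¬ x ≡ y → rk x < rk y
  rk-< {x} {y} = byIntervalSize (intervalSize x y) x y ℕP.≤-refl
    where
    byIntervalSize : ∀ m x y → intervalSize x y ≤ m → x ≤P y → ¬ x ≡ y → rk x < rk y
    byIntervalSize m x y size≤m x≤y x≢y
      with FinP.any? (λ z → (x ≤P? z) ×-dec (z ≤P? y) ×-dec ¬? (z FinP.≟ x) ×-dec ¬? (z FinP.≟ y))
    ... | no nothingBetween =
      subst (rk x <_) (sym (rk-cover x y x≤y x≢y covers)) (ℕP.n<1+n (rk x))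
      where
      covers : ∀ z → x ≤P z → z ≤P y → z ≡ x ⊎ z ≡ y
      covers z x≤z z≤y with z FinP.≟ x | z FinP.≟ y
      ... | yes e | _     = inj₁ e
      ... | no _  | yes e = inj₂ e
      ... | no c  | no d  = contradiction (z , x≤z , z≤y , c , d) nothingBetween
    ... | yes (z , x≤z , z≤y , z≢x , z≢y) = split m size≤m
      where
      left-smaller : intervalSize x z < intervalSize x y
      left-smaller = length-filterB-< (between x z) (between x y) (allFin size)
        (λ w e → let (a , b) = between-elim e in between-intro a (≤-trans b z≤y))
        y (∈-allFin y)
        (between-false₂ (λ y≤z → z≢y (≤-antisym z≤y y≤z)))
        (between-intro x≤y (≤-refl y))
      right-smaller : intervalSize z y < intervalSize x y
      right-smaller = length-filterB-< (between z y) (between x y) (allFin size)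
        (λ w e → let (a , b) = between-elim e in between-intro (≤-trans x≤z a) b)
        x (∈-allFin x)
        (between-false₁ (λ z≤x → z≢x (≤-antisym z≤x x≤z)))
        (between-intro (≤-refl x) x≤y)
      split : ∀ m → intervalSize x y ≤ m → rk x < rk y
      split zero    size≤m = contradiction (ℕP.<-≤-trans left-smaller size≤m) ℕP.n≮0
      split (suc m) size≤m =
        ℕP.<-trans (byIntervalSize m x z (ℕP.≤-pred (ℕP.≤-trans left-smaller size≤m)) x≤z (λ e → z≢x (sym e)))
                   (byIntervalSize m z y (ℕP.≤-pred (ℕP.≤-trans right-smaller size≤m)) z≤y z≢y)

  rk-≤ : ∀ {x y} → x ≤P y → rk x ≤ rk y
  rk-≤ {x} {y} x≤y with x FinP.≟ y
  ... | yes refl = ℕP.≤-refl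
  ... | no x≢y   = ℕP.<⇒≤ (rk-< x≤y x≢y)

  rk≤len : ∀ p → rk p ≤ len
  rk≤len p = rk-≤ (top-max p)

  rk-pos : ∀ {p} → ¬ p ≡ bot → 1 ≤ rk p
  rk-pos {p} p≢bot = subst (_< rk p) rk-bot (rk-< (bot-min p) (λ e → p≢bot (sym e)))

module TreeWords (P : BoundedRankedPoset) (t : ℕ) where

  open import Data.Nat using (zero; _^_; s≤s)
  import Data.Nat.Properties as ℕP
  open import Data.Integer using (+_; _*_)
  import Data.Integer.Properties as ℤP
  import Data.Fin.Properties as FinP
  open import Data.List using (List; []; _∷_; map; allFin; upTo; take)
  import Data.List.Properties as ListP
  open import Data.List.Relation.Unary.All using (All; []; _∷_)
  import Data.List.Relation.Unary.All as All
  import Data.List.Relation.Unary.All.Properties as AllP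
  open import Data.List.Relation.Unary.Unique.Propositional.Properties using (allFin⁺)
  open import Data.List.Membership.Propositional.Properties using (∈-allFin)
  open import Data.List.Relation.Binary.Prefix.Heterogeneous using (Prefix; []; _∷_)
  open import Data.List.Relation.Binary.Prefix.Heterogeneous.Properties using (prefix?)
  open import Relation.Nullary using (does)
  open import Data.Bool using (Bool)
  open import Relation.Binary.PropositionalEquality using (refl; cong; sym; trans; module ≡-Reasoning)
  open Constructions P using (wordsOfLength; treeVertices; n)
  open FiniteSums
  open PointSums {C = Fin t} FinP._≟_
  open Decisions

  Word : Set
  Word = List (Fin t)

  isPrefix : Word → Word → Bool
  isPrefix v u = does (prefix? FinP._≟_ v u)

  words : ℕ → List Word
  words = wordsOfLength t

  words-length : ∀ ℓ → All (λ v → length v ≡ ℓ) (words ℓ)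
  words-length zero    = refl ∷ []
  words-length (suc ℓ) = AllP.concat⁺ (AllP.map⁺ (extend (allFin t)))
    where
    extend : (is : List (Fin t)) → All (λ i → All (λ v → length v ≡ suc ℓ) (map (i ∷_) (words ℓ))) is
    extend []       = []
    extend (i ∷ is) = AllP.map⁺ (All.map (cong suc) (words-length ℓ)) ∷ extend is

  words-count : ∀ ℓ (c : ℤ) → sumOver (words ℓ) (λ _ → c) ≡ + (t ^ ℓ) * c
  words-count zero    c = trans (ℤP.+-identityʳ c) (sym (ℤP.*-identityˡ c))
  words-count (suc ℓ) c = begin
    sumOver (words (suc ℓ)) (λ _ → c)
      ≡⟨ sumOver-concatMap (λ i → map (i ∷_) (words ℓ)) (allFin t) (λ _ → c) ⟩
    sumOver (allFin t) (λ i → sumOver (map (i ∷_) (words ℓ)) (λ _ → c))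
      ≡⟨ sumOver-cong (allFin t) (λ i → trans (sumOver-map (i ∷_) (words ℓ) (λ _ → c)) (words-count ℓ c)) ⟩
    sumOver (allFin t) (λ _ → + (t ^ ℓ) * c)
      ≡⟨ sumOver-const (allFin t) (+ (t ^ ℓ) * c) ⟩
    + length (allFin t) * (+ (t ^ ℓ) * c)
      ≡⟨ cong (λ m → + m * (+ (t ^ ℓ) * c)) (ListP.length-tabulate {n = t} (λ i → i)) ⟩
    + t * (+ (t ^ ℓ) * c)
      ≡⟨ sym (ℤP.*-assoc (+ t) (+ (t ^ ℓ)) c) ⟩
    + t * + (t ^ ℓ) * c
      ≡⟨ cong (_* c) (sym (ℤP.pos-* t (t ^ ℓ))) ⟩
    + (t ^ suc ℓ) * c ∎
    where open ≡-Reasoning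

  take-prefix : ∀ {A : Set} ℓ (u : List A) → Prefix _≡_ (take ℓ u) u
  take-prefix zero    u       = []
  take-prefix (suc ℓ) []      = []
  take-prefix (suc ℓ) (a ∷ u) = refl ∷ take-prefix ℓ u

  take-shorter : ∀ {A : Set} {ℓ ℓ'} (u : List A) → ℓ ≤ ℓ' → take ℓ (take ℓ' u) ≡ take ℓ u
  take-shorter {ℓ = ℓ} {ℓ'} u ℓ≤ℓ' = trans (ListP.take-take ℓ ℓ' u) (cong (λ m → take m u) (ℕP.m≤n⇒m⊓n≡m ℓ≤ℓ'))

  -- The only word of length ℓ that is a prefix of u is take ℓ u (if ℓ ≤ |u|).
  prefixSum-level : ∀ ℓ (u : Word) (G : Word → ℤ) →
    sumOver (words ℓ) (λ v → guard (isPrefix v u) (G v)) ≡ guard (does (ℓ ℕP.≤? length u)) (G (take ℓ u))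
  prefixSum-level zero    u G = ℤP.+-identityʳ _
  prefixSum-level (suc ℓ) [] G = begin
    sumOver (words (suc ℓ)) (λ v → guard (isPrefix v []) (G v))
      ≡⟨ sumOver-concatMap (λ i → map (i ∷_) (words ℓ)) (allFin t) _ ⟩
    sumOver (allFin t) (λ i → sumOver (map (i ∷_) (words ℓ)) (λ v → guard (isPrefix v []) (G v)))
      ≡⟨ sumOver-cong (allFin t) (λ i → trans (sumOver-map (i ∷_) (words ℓ) _) (sumOver-zero (words ℓ))) ⟩
    sumOver (allFin t) (λ _ → + 0)
      ≡⟨ sumOver-zero (allFin t) ⟩
    + 0 ∎
    where open ≡-Reasoning
  prefixSum-level (suc ℓ) (a ∷ u) G = begin
    sumOver (words (suc ℓ)) (λ v → guard (isPrefix v (a ∷ u)) (G v))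
      ≡⟨ sumOver-concatMap (λ i → map (i ∷_) (words ℓ)) (allFin t) _ ⟩
    sumOver (allFin t) (λ i → sumOver (map (i ∷_) (words ℓ)) (λ v → guard (isPrefix v (a ∷ u)) (G v)))
      ≡⟨ sumOver-cong (allFin t) (λ i → trans (sumOver-map (i ∷_) (words ℓ) _)
           (trans (sumOver-cong (words ℓ) (λ v → guard-∧ (does (i FinP.≟ a)) (isPrefix v u) (G (i ∷ v))))
                  (sumOver-guard (does (i FinP.≟ a)) (words ℓ) _))) ⟩
    sumOver (allFin t) (λ i → guard (does (i FinP.≟ a)) (sumOver (words ℓ) (λ v → guard (isPrefix v u) (G (i ∷ v)))))
      ≡⟨ sumOver-point (allFin t) a _ (allFin⁺ t) (∈-allFin a) ⟩
    sumOver (words ℓ) (λ v → guard (isPrefix v u) (G (a ∷ v)))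
      ≡⟨ prefixSum-level ℓ u (λ v → G (a ∷ v)) ⟩
    guard (does (ℓ ℕP.≤? length u)) (G (a ∷ take ℓ u))
      ≡⟨ cong (λ b → guard b (G (a ∷ take ℓ u))) (does-iff (ℓ ℕP.≤? length u) (suc ℓ ℕP.≤? suc (length u)) s≤s ℕP.≤-pred) ⟩
    guard (does (suc ℓ ℕP.≤? length (a ∷ u))) (G (take (suc ℓ) (a ∷ u))) ∎
    where open ≡-Reasoning

  prefixSum : ∀ (u : Word) (G : Word → ℤ) →
    sumOver (treeVertices t) (λ v → guard (isPrefix v u) (G v)) ≡
    sumOver (upTo (suc n)) (λ ℓ → guard (does (ℓ ℕP.≤? length u)) (G (take ℓ u)))
  prefixSum u G = trans (sumOver-concatMap words (upTo (suc n)) (λ v → guard (isPrefix v u) (G v)))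
                        (sumOver-cong (upTo (suc n)) (λ ℓ → prefixSum-level ℓ u G))

module SegmentSums where

  open import Data.Nat using (zero; _<_; _∸_; _<ᵇ_; z≤n; s≤s)
  import Data.Nat.Properties as ℕP
  open import Data.Integer using (+_; _+_)
  import Data.Integer.Properties as ℤP
  import Data.Fin as Fin
  open import Data.List using (allFin; upTo; applyUpTo)
  import Data.List.Properties as ListP
  open import Function using (_∘_; id)
  open import Relation.Binary.PropositionalEquality using (refl; cong; cong₂; sym; trans; module ≡-Reasoning)
  open FiniteSums

  Σ< : ℕ → (ℕ → ℤ) → ℤ
  Σ< zero    f = + 0
  Σ< (suc m) f = f 0 + Σ< m (f ∘ suc)

  Σ<-cong : ∀ m {f g : ℕ → ℤ} → (∀ i → i < m → f i ≡ g i) → Σ< m f ≡ Σ< m g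
  Σ<-cong zero    h = refl
  Σ<-cong (suc m) h = cong₂ _+_ (h 0 (s≤s z≤n)) (Σ<-cong m (λ i i<m → h (suc i) (s≤s i<m)))

  Σ<-applyUpTo : ∀ m (g : ℕ → ℕ) (h : ℕ → ℤ) → sumOver (applyUpTo g m) h ≡ Σ< m (h ∘ g)
  Σ<-applyUpTo zero    g h = refl
  Σ<-applyUpTo (suc m) g h = cong (_+_ (h (g 0))) (Σ<-applyUpTo m (g ∘ suc) h)

  Σ<-allFin : ∀ m (F : ℕ → ℤ) → sumOver (allFin m) (F ∘ toℕ) ≡ Σ< m F
  Σ<-allFin zero    F = refl
  Σ<-allFin (suc m) F = cong (_+_ (F 0)) (begin
    sumOver (Data.List.tabulate {n = m} Fin.suc) (F ∘ toℕ)  ≡⟨ cong (λ l → sumOver l (F ∘ toℕ)) (sym (ListP.map-tabulate {n = m} id Fin.suc)) ⟩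
    sumOver (Data.List.map Fin.suc (allFin m)) (F ∘ toℕ) ≡⟨ sumOver-map Fin.suc (allFin m) (F ∘ toℕ) ⟩
    sumOver (allFin m) (F ∘ suc ∘ toℕ)               ≡⟨ Σ<-allFin m (F ∘ suc) ⟩
    Σ< m (F ∘ suc) ∎)
    where
    open ≡-Reasoning
    import Data.List

  Σ<-last : ∀ m (f : ℕ → ℤ) → Σ< (suc m) f ≡ Σ< m f + f m
  Σ<-last zero    f = trans (ℤP.+-identityʳ (f 0)) (sym (ℤP.+-identityˡ (f 0)))
  Σ<-last (suc m) f = trans (cong (_+_ (f 0)) (Σ<-last m (f ∘ suc))) (sym (ℤP.+-assoc (f 0) _ _))

  Σ<-zero : ∀ m → Σ< m (λ _ → + 0) ≡ + 0
  Σ<-zero zero    = refl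
  Σ<-zero (suc m) = trans (ℤP.+-identityˡ _) (Σ<-zero m)

  Σ<-truncate : ∀ k m (f : ℕ → ℤ) → k ≤ m → Σ< m (λ i → guard (i <ᵇ k) (f i)) ≡ Σ< k f
  Σ<-truncate zero m f _ = trans (Σ<-cong m (λ i _ → nothing-below-0 i)) (Σ<-zero m)
    where
    nothing-below-0 : ∀ i → guard (i <ᵇ 0) (f i) ≡ + 0
    nothing-below-0 zero    = refl
    nothing-below-0 (suc i) = refl
  Σ<-truncate (suc k) (suc m) f (s≤s k≤m) = cong (_+_ (f 0)) (Σ<-truncate k m (f ∘ suc) k≤m)

  Σ<-reverse : ∀ k (f : ℕ → ℤ) → Σ< k (λ i → f (k ∸ 1 ∸ i)) ≡ Σ< k f
  Σ<-reverse zero    f = refl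
  Σ<-reverse (suc k) f = begin
    f k + Σ< k (λ i → f (k ∸ suc i)) ≡⟨ cong (_+_ (f k)) (Σ<-cong k (λ i _ → cong f (∸-suc k i))) ⟩
    f k + Σ< k (λ i → f (k ∸ 1 ∸ i)) ≡⟨ cong (_+_ (f k)) (Σ<-reverse k f) ⟩
    f k + Σ< k f                     ≡⟨ ℤP.+-comm (f k) (Σ< k f) ⟩
    Σ< k f + f k                     ≡⟨ sym (Σ<-last k f) ⟩
    Σ< (suc k) f                     ∎
    where
    open ≡-Reasoning
    ∸-suc : ∀ k i → k ∸ suc i ≡ k ∸ 1 ∸ i
    ∸-suc zero    i = sym (ℕP.0∸n≡0 i)
    ∸-suc (suc k) i = refl

  reflect-segment : ∀ n k (F : ℕ → ℤ) → k ≤ n →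
    sumOver (allFin n) (λ i → guard (toℕ i <ᵇ k) (F (k ∸ 1 ∸ toℕ i))) ≡
    sumOver (upTo (suc n)) (λ ℓ → guard (ℓ <ᵇ k) (F ℓ))
  reflect-segment n k F k≤n = begin
    sumOver (allFin n) (λ i → guard (toℕ i <ᵇ k) (F (k ∸ 1 ∸ toℕ i)))
      ≡⟨ Σ<-allFin n (λ i → guard (i <ᵇ k) (F (k ∸ 1 ∸ i))) ⟩
    Σ< n (λ i → guard (i <ᵇ k) (F (k ∸ 1 ∸ i)))
      ≡⟨ Σ<-truncate k n (λ i → F (k ∸ 1 ∸ i)) k≤n ⟩
    Σ< k (λ i → F (k ∸ 1 ∸ i))
      ≡⟨ Σ<-reverse k F ⟩
    Σ< k F
      ≡⟨ sym (Σ<-truncate k (suc n) F (ℕP.m≤n⇒m≤1+n k≤n)) ⟩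
    Σ< (suc n) (λ ℓ → guard (ℓ <ᵇ k) (F ℓ))
      ≡⟨ sym (Σ<-applyUpTo (suc n) id (λ ℓ → guard (ℓ <ᵇ k) (F ℓ))) ⟩
    sumOver (upTo (suc n)) (λ ℓ → guard (ℓ <ᵇ k) (F ℓ)) ∎
    where open ≡-Reasoning

-- Throughout, r and r' are ranks in P (at most n),
-- ℓ, ℓ' are word lengths and a, a' are chain indices with a + ℓ = j.
module ReesArithmetic where

  open import Data.Nat using (zero; _∸_; _+_; z≤n; s≤s)
  open import Data.Nat.Properties
  open import Data.Nat.Tactic.RingSolver using (solve-∀)
  open import Data.Product using (_×_; _,_)
  open import Function.Bundles using (_⇔_; mk⇔)
  open import Relation.Nullary using (contradiction)
  open import Relation.Binary.PropositionalEquality using (refl; cong; sym; trans; subst; subst₂)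

  -- Membership (p, v) ∈ P* ∗ T:  |v| ≤ n - rk p.
  dualRank⇔ : ∀ ℓ r n → r ≤ n → (ℓ ≤ n ∸ r) ⇔ (ℓ + r ≤ n)
  dualRank⇔ ℓ r n r≤n = mk⇔ (m≤o∸n⇒m+n≤o ℓ r≤n) (m+n≤o⇒m≤o∸n ℓ)

  -- (1̂, root) ≤ (p, v) in P* ∗ T.
  aboveBase⇔ : ∀ ℓ r n → r ≤ n → (ℓ + (n ∸ n) ≤ (n ∸ r) + 0) ⇔ (ℓ + r ≤ n)
  aboveBase⇔ ℓ r n r≤n rewrite n∸n≡0 n | +-identityʳ ℓ | +-identityʳ (n ∸ r) = dualRank⇔ ℓ r n r≤n

  -- The rank condition for (p, v) ≤ (q, u) in P* ∗ T, with |v| = ℓ, |u| = ℓ'.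
  dualRees⇔ : ∀ ℓ ℓ' r r' n → r ≤ n → r' ≤ n →
              (ℓ' + (n ∸ r) ≤ (n ∸ r') + ℓ) ⇔ (ℓ' + r' ≤ r + ℓ)
  dualRees⇔ ℓ ℓ' r r' n r≤n r'≤n = mk⇔
    (λ h → +-cancelʳ-≤ n _ _ (subst₂ _≤_ e₁ e₂ (+-monoˡ-≤ (r + r') h)))
    (λ h → +-cancelʳ-≤ (r + r') _ _ (subst₂ _≤_ (sym e₁) (sym e₂) (+-monoˡ-≤ n h)))
    where
    shuffle₁ : ∀ a b c d → (a + b) + (c + d) ≡ (a + d) + (b + c)
    shuffle₁ = solve-∀
    shuffle₂ : ∀ a b c d → (a + b) + (c + d) ≡ (c + b) + (a + d)
    shuffle₂ = solve-∀
    e₁ : (ℓ' + (n ∸ r)) + (r + r') ≡ (ℓ' + r') + n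
    e₁ = trans (shuffle₁ ℓ' (n ∸ r) r r') (cong ((ℓ' + r') +_) (m∸n+n≡m r≤n))
    e₂ : ((n ∸ r') + ℓ) + (r + r') ≡ (r + ℓ) + n
    e₂ = trans (shuffle₂ (n ∸ r') ℓ r r') (cong ((r + ℓ) +_) (m∸n+n≡m r'≤n))

  -- Membership (p, a) ∈ P⁻ ∗ C_n (p ≠ 0̂, a ≤ rk p - 1), with a + ℓ = j.
  chainRank⇔ : ∀ a ℓ j r → a + ℓ ≡ j → (1 ≤ r × a ≤ r ∸ 1) ⇔ (suc j ≤ r + ℓ)
  chainRank⇔ a ℓ j (suc r) refl =
    mk⇔ (λ (_ , h) → s≤s (+-monoˡ-≤ ℓ h)) (λ { (s≤s h) → s≤s z≤n , +-cancelʳ-≤ ℓ a r h })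
  chainRank⇔ a ℓ j zero refl =
    mk⇔ (λ { (() , _) }) (λ h → contradiction (≤-trans (s≤s (m≤n+m ℓ a)) h) (<-irrefl refl))

  -- The rank condition for (p, a) ≤ (1̂, j) in P⁻ ∗ C_n.
  belowTop⇔ : ∀ a ℓ j r n → a + ℓ ≡ j → 1 ≤ r → 1 ≤ n →
              (j + (r ∸ 1) ≤ (n ∸ 1) + a) ⇔ (ℓ + r ≤ n)
  belowTop⇔ a ℓ j (suc r) (suc n) refl _ _ = mk⇔
    (λ h → subst (_≤ suc n) (sym (+-suc ℓ r)) (s≤s (+-cancelʳ-≤ a _ _ (subst (_≤ n + a) (shuffle a ℓ r) h))))
    (λ h → subst (_≤ n + a) (sym (shuffle a ℓ r)) (+-monoˡ-≤ a (≤-pred (subst (_≤ suc n) (+-suc ℓ r) h))))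
    where
    shuffle : ∀ a ℓ r → a + ℓ + r ≡ (ℓ + r) + a
    shuffle = solve-∀

  chainTop⇔ : ∀ a ℓ j → a + ℓ ≡ j → (a ≡ j) ⇔ (ℓ ≡ 0)
  chainTop⇔ a ℓ j refl =
    mk⇔ (λ e → +-cancelˡ-≡ a ℓ 0 (trans (sym e) (sym (+-identityʳ a)))) (λ { refl → sym (+-identityʳ a) })

  -- Chain indices are ordered oppositely to word lengths.
  chainOrder⇔ : ∀ a ℓ a' ℓ' j → a + ℓ ≡ j → a' + ℓ' ≡ j → (a' ≤ a) ⇔ (ℓ ≤ ℓ')
  chainOrder⇔ a ℓ a' ℓ' j e e' = mk⇔
    (λ h → +-cancelˡ-≤ a ℓ ℓ' (≤-trans (≤-reflexive (trans e (sym e'))) (+-monoˡ-≤ ℓ' h)))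
    (λ h → +-cancelʳ-≤ ℓ' a' a (≤-trans (≤-reflexive (trans e' (sym e))) (+-monoʳ-≤ a h)))

  chainEq⇔ : ∀ a ℓ a' ℓ' j → a + ℓ ≡ j → a' + ℓ' ≡ j → (a ≡ a') ⇔ (ℓ ≡ ℓ')
  chainEq⇔ a ℓ a' ℓ' j e e' = mk⇔ (λ { refl → +-cancelˡ-≡ a ℓ ℓ' (trans e (sym e')) })
                                   (λ { refl → +-cancelʳ-≡ ℓ a a' (trans e (sym e')) })

  -- The rank condition for (p', a') ≤ (p, a) in P⁻ ∗ C_n, with ranks r, r' ≥ 1.
  chainRees⇔ : ∀ a ℓ a' ℓ' j r r' → a + ℓ ≡ j → a' + ℓ' ≡ j → 1 ≤ r → 1 ≤ r' →
               (a + (r' ∸ 1) ≤ (r ∸ 1) + a') ⇔ (ℓ' + r' ≤ r + ℓ)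
  chainRees⇔ a ℓ a' ℓ' j (suc r) (suc r') e e' _ _ = mk⇔
    (λ h → subst (_≤ suc r + ℓ) (sym (+-suc ℓ' r'))
             (s≤s (+-cancelˡ-≤ j _ _ (subst₂ _≤_ x₁ x₂ (+-monoˡ-≤ (ℓ + ℓ') h)))))
    (λ h → +-cancelʳ-≤ (ℓ + ℓ') _ _ (subst₂ _≤_ (sym x₁) (sym x₂)
             (+-monoʳ-≤ j (≤-pred (subst (_≤ suc r + ℓ) (+-suc ℓ' r') h)))))
    where
    shuffle₁ : ∀ a r' ℓ ℓ' → (a + r') + (ℓ + ℓ') ≡ (a + ℓ) + (ℓ' + r')
    shuffle₁ = solve-∀
    shuffle₂ : ∀ r a' ℓ ℓ' → (r + a') + (ℓ + ℓ') ≡ (a' + ℓ') + (r + ℓ)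
    shuffle₂ = solve-∀
    x₁ : (a + r') + (ℓ + ℓ') ≡ j + (ℓ' + r')
    x₁ = trans (shuffle₁ a r' ℓ ℓ') (cong (_+ (ℓ' + r')) e)
    x₂ : (r + a') + (ℓ + ℓ') ≡ j + (r + ℓ)
    x₂ = trans (shuffle₂ r a' ℓ ℓ') (cong (_+ (r + ℓ)) e')

module ReesTree (P : BoundedRankedPoset) (t : ℕ) where

  open import Data.Nat using (_+_; z≤n; s≤s)
  import Data.Nat.Properties as ℕP
  open import Data.Integer using (+_) renaming (_+_ to _⊕_)
  import Data.Integer.Properties as ℤP
  import Data.Fin.Properties as FinP
  open import Data.List using (List; []; map; concatMap; allFin; upTo; take)
  import Data.List.Properties as ListP
  open import Data.List.Membership.Propositional.Properties using (∈-allFin; ∈-map⁺; ∈-concatMap⁺; ∈-upTo⁺)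
  open import Data.List.Relation.Unary.Any using (here)
  import Data.List.Relation.Unary.Any as Any
  open import Data.List.Relation.Unary.Unique.Propositional.Properties using (allFin⁺; upTo⁺)
  open import Data.List.Relation.Binary.Prefix.Heterogeneous using ([])
  open import Data.List.Relation.Binary.Prefix.Heterogeneous.Properties using (prefix?)
  open import Data.Bool using (Bool; true; false; _∧_; not)
  open import Data.Unit using (⊤; tt)
  open import Data.Product using (_×_; _,_; proj₁; proj₂)
  open import Data.Maybe using (just)
  open import Function.Bundles using (module Equivalence)
  open import Relation.Nullary using (does; ¬_)
  open import Data.Sum using ([_,_]′)
  open import Relation.Nullary.Decidable using (dec-true; dec-false; _⊎-dec_)
  open import Relation.Binary.Structures using (IsPartialOrder)
  import Relation.Binary.Construct.Flip.EqAndOrd as Flip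
  open import Relation.Binary.PropositionalEquality using (refl; cong; cong₂; sym; trans; subst; module ≡-Reasoning)
  open BoundedRankedPoset P
  open Constructions P
  open RankedPosets P using (rk-≤; rk≤len) renaming (isPartialOrder to P-isPartialOrder)
  open TreeWords P t
  open FiniteSums
  open Decisions
  open MöbiusFunction
  open OrderConstructions
  open ReesArithmetic
  open Equivalence

  Q : FinOrd
  Q = reesDualTree t
  module Q = FinOrd Q

  Q-isPartialOrder : IsPartialOrder _≡_ Q._≼_
  Q-isPartialOrder = rees-isPartialOrder {rA = rkDual} {rB = length}
                       (Flip.isPartialOrder P-isPartialOrder) prefix-isPartialOrder

  module Qμ = FinitePoset Q Q-isPartialOrder

  μQ : Q.Carrier → Q.Carrier → ℤ
  μQ = Qμ.μ

  m₀ : Fin size × Word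
  m₀ = (top , [])

  inQ? : Fin size × Word → Bool
  inQ? (p , v) = does (length v ℕP.≤? rkDual p)

  candidates : List (Fin size × Word)
  candidates = concatMap (λ p → map (p ,_) (treeVertices t)) (allFin size)

  ∈Q : ∀ p v → v ∈ treeVertices t → length v ≤ rkDual p → (p , v) ∈ Q.elems
  ∈Q p v v∈ v≤ = filterB-∈⁺ inQ? (dec-true (length v ℕP.≤? rkDual p) v≤)
                   (∈-concatMap⁺ (λ q → map (q ,_) (treeVertices t)) (Any.map (λ { refl → ∈-map⁺ (p ,_) v∈ }) (∈-allFin p)))

  m₀∈Q : m₀ ∈ Q.elems
  m₀∈Q = ∈Q top [] (here refl) z≤n

  -- m₀ ≤ (p, v) holds exactly when (p, v) ∈ Q.
  m₀≼ : ∀ p v → length v + rk p ≤ n → m₀ Q.≼ (p , v)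
  m₀≼ p v h = top-max p , [] , from (aboveBase⇔ (length v) (rk p) n (rk≤len p)) h

  -- μ(Q⁺) is computed from μ_Q: Q embeds into Q⁺ as the elements below the new maximum.
  μ-plus : μReesPlus t ≡ - sumOver Q.elems (λ z → guard (does (m₀ Q.≼? z)) (μQ m₀ z))
  μ-plus = cong -_ (begin
    sumWhere _ (möbiusFuel (plus Q) (length (map just Q.elems)) (just m₀)) (map just Q.elems)
      ≡⟨ sumWhere-map _ _ just Q.elems ⟩
    sumWhere _ _ Q.elems
      ≡⟨ sumWhere≡sumOver _ _ Q.elems ⟩
    sumOver Q.elems _
      ≡⟨ sumOver-cong Q.elems (λ z → cong₂ guard (guard-test z) (μ⁺≡μQ z)) ⟩
    sumOver Q.elems (λ z → guard (does (m₀ Q.≼? z)) (μQ m₀ z)) ∎)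
    where
    open ≡-Reasoning
    open PlusEmbedding Q
    halfOpen-just : ∀ y z → halfOpen (plus Q) (just m₀) (just y) (just z) ≡ halfOpen Q m₀ y z
    halfOpen-just y z rewrite plus-≼-just m₀ z | plus-≼-just z y | plus-≟-just z y = refl
    module ToPlus = Transport Q (plus Q) just m₀ (λ _ → ⊤)
      (λ y _ → plus-≟-just m₀ y) (λ y _ → plus-≼-just m₀ y)
      (λ y _ _ _ g → trans (sumWhere-map _ g just Q.elems)
                           (sumWhere-cong-test _ _ _ Q.elems (λ z → halfOpen-just y z)))
      (λ _ _ _ _ _ → tt)
    ∧-true-true : ∀ b → b ∧ true ∧ true ≡ b
    ∧-true-true true  = refl
    ∧-true-true false = refl
    guard-test : ∀ z → does (X⁺._≼?_ (just m₀) (just z)) ∧ true ∧ true ≡ does (m₀ Q.≼? z)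
    guard-test z = trans (∧-true-true _) (plus-≼-just m₀ z)
    μ⁺≡μQ : ∀ z → möbiusFuel (plus Q) (length (map just Q.elems)) (just m₀) (just z) ≡ μQ m₀ z
    μ⁺≡μQ z = trans (sym (ToPlus.transport (length (map just Q.elems)) z tt))
                    (Qμ.μ-fuel m₀ m₀∈Q _ z (subst (Qμ.height z ≤_) (sym (ListP.length-map just Q.elems))
                                                 (Qμ.height-bounded z)))

  sumWhere-Q : (C : Q.Carrier → Bool) (g : Q.Carrier → ℤ) →
    sumWhere C g Q.elems ≡
    sumOver (allFin size) (λ p → sumOver (treeVertices t) (λ v → guard (inQ? (p , v) ∧ C (p , v)) (g (p , v))))
  sumWhere-Q C g = begin
    sumWhere C g Q.elems
      ≡⟨ sumWhere≡sumOver C g Q.elems ⟩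
    sumOver (filterB inQ? candidates) (λ z → guard (C z) (g z))
      ≡⟨ sumOver-filterB inQ? candidates _ ⟩
    sumOver candidates (λ z → guard (inQ? z) (guard (C z) (g z)))
      ≡⟨ sumOver-concatMap (λ p → map (p ,_) (treeVertices t)) (allFin size) _ ⟩
    sumOver (allFin size) (λ p → sumOver (map (p ,_) (treeVertices t)) (λ z → guard (inQ? z) (guard (C z) (g z))))
      ≡⟨ sumOver-cong (allFin size) (λ p →
           trans (sumOver-map (p ,_) (treeVertices t) (λ z → guard (inQ? z) (guard (C z) (g z))))
                 (sumOver-cong (treeVertices t) (λ v → sym (guard-∧ (inQ? (p , v)) (C (p , v)) (g (p , v)))))) ⟩
    sumOver (allFin size) (λ p → sumOver (treeVertices t) (λ v → guard (inQ? (p , v) ∧ C (p , v)) (g (p , v)))) ∎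
    where open ≡-Reasoning

  halfOpen-prefix : ∀ q u p v → halfOpen Q m₀ (q , u) (p , v) ≡ true → isPrefix v u ≡ true
  halfOpen-prefix q u p v e =
    let (_ , (_ , v⊑u , _) , _) = halfOpen-elim Q e in dec-true (prefix? FinP._≟_ v u) v⊑u

  halfOpenSum : ∀ q u (g : Q.Carrier → ℤ) →
    sumWhere (halfOpen Q m₀ (q , u)) g Q.elems ≡
    sumOver (allFin size) (λ p → sumOver (upTo (suc n)) (λ ℓ → guard (does (ℓ ℕP.≤? length u))
      (guard (inQ? (p , take ℓ u) ∧ halfOpen Q m₀ (q , u) (p , take ℓ u)) (g (p , take ℓ u)))))
  halfOpenSum q u g = trans (sumWhere-Q (halfOpen Q m₀ (q , u)) g) (sumOver-cong (allFin size) (λ p →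
    trans (sumOver-cong (treeVertices t) (λ v → sym (guard-implied (isPrefix v u) _ (g (p , v))
             (λ e → halfOpen-prefix q u p v (proj₂ (∧-true {inQ? (p , v)} e))))))
          (prefixSum u (λ v → guard (inQ? (p , v) ∧ halfOpen Q m₀ (q , u) (p , v)) (g (p , v))))))

  μFromBase : Fin size → Word → ℤ
  μFromBase p v = guard (inQ? (p , v) ∧ does (m₀ Q.≼? (p , v))) (μQ m₀ (p , v))

  levelSum : ℕ → ℤ
  levelSum ℓ = sumOver (words ℓ) (λ v → sumOver (allFin size) (λ p → μFromBase p v))

  sum-by-levels : sumOver Q.elems (λ z → guard (does (m₀ Q.≼? z)) (μQ m₀ z)) ≡ sumOver (upTo (suc n)) levelSum
  sum-by-levels = begin
    sumOver Q.elems (λ z → guard (does (m₀ Q.≼? z)) (μQ m₀ z))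
      ≡⟨ sym (sumWhere≡sumOver (λ z → does (m₀ Q.≼? z)) (μQ m₀) Q.elems) ⟩
    sumWhere (λ z → does (m₀ Q.≼? z)) (μQ m₀) Q.elems
      ≡⟨ sumWhere-Q (λ z → does (m₀ Q.≼? z)) (μQ m₀) ⟩
    sumOver (allFin size) (λ p → sumOver (concatMap words (upTo (suc n))) (μFromBase p))
      ≡⟨ sumOver-cong (allFin size) (λ p → sumOver-concatMap words (upTo (suc n)) (μFromBase p)) ⟩
    sumOver (allFin size) (λ p → sumOver (upTo (suc n)) (λ ℓ → sumOver (words ℓ) (μFromBase p)))
      ≡⟨ sumOver-swap (allFin size) (upTo (suc n)) _ ⟩
    sumOver (upTo (suc n)) (λ ℓ → sumOver (allFin size) (λ p → sumOver (words ℓ) (μFromBase p)))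
      ≡⟨ sumOver-cong (upTo (suc n)) (λ ℓ → sumOver-swap (allFin size) (words ℓ) μFromBase) ⟩
    sumOver (upTo (suc n)) levelSum ∎
    where open ≡-Reasoning

  wordSum : Word → ℤ
  wordSum w = sumOver (allFin size) (λ p → μFromBase p w)

  shorterSum : Word → ℤ
  shorterSum w = sumOver (allFin size) (λ p → sumOver (upTo (suc n)) (λ ℓ → guard (does (ℓ ℕP.<? length w))
    (guard (inQ? (p , take ℓ w) ∧ halfOpen Q m₀ (bot , w) (p , take ℓ w)) (μQ m₀ (p , take ℓ w)))))

  -- Fix a word w of T.  The elements of Q carrying w are (0̂, w), their maximum,
  -- and the (p, w) with p ≠ 0̂, which lie in [m₀, (0̂, w)).
  module WordRecursion (w : Word) (w∈T : w ∈ treeVertices t) (|w|≤n : length w ≤ n) (top≢bot : ¬ top ≡ bot) where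
    open ≡-Reasoning

    y₀ : Q.Carrier
    y₀ = (bot , w)

    others : ℤ
    others = sumOver (allFin size) (λ p → guard (not (does (p FinP.≟ bot))) (μFromBase p w))

    |w|+rk-bot≤n : length w + rk bot ≤ n
    |w|+rk-bot≤n = subst (λ r → length w + r ≤ n) (sym rk-bot) (subst (_≤ n) (sym (ℕP.+-identityʳ _)) |w|≤n)

    y₀∈Q : y₀ ∈ Q.elems
    y₀∈Q = ∈Q bot w w∈T (from (dualRank⇔ (length w) (rk bot) n (rk≤len bot)) |w|+rk-bot≤n)

    m₀≼y₀ : m₀ Q.≼ y₀
    m₀≼y₀ = m₀≼ bot w |w|+rk-bot≤n

    μFromBase-bot : μFromBase bot w ≡ μQ m₀ y₀
    μFromBase-bot = cong (λ b → guard b (μQ m₀ y₀))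
                         (cong₂ _∧_ (proj₁ (filterB-∈ inQ? {xs = candidates} y₀∈Q)) (dec-true (m₀ Q.≼? y₀) m₀≼y₀))

    ≼y₀ : ∀ p → (p , w) Q.≼ y₀
    ≼y₀ p = bot-min p , prefix-refl ,
            ℕP.≤-trans (ℕP.+-monoʳ-≤ (length w) (ℕP.∸-monoʳ-≤ n (rk-≤ (bot-min p))))
                       (ℕP.≤-reflexive (ℕP.+-comm (length w) (rkDual bot)))
      where prefix-refl = IsPartialOrder.refl prefix-isPartialOrder

    same-word : ∀ p → guard (inQ? (p , w) ∧ halfOpen Q m₀ y₀ (p , w)) (μQ m₀ (p , w)) ≡
                      guard (not (does (p FinP.≟ bot))) (μFromBase p w)
    same-word p = trans (cong (λ b → guard (inQ? (p , w) ∧ does (m₀ Q.≼? (p , w)) ∧ b) (μQ m₀ (p , w)))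
                              (cong₂ _∧_ (dec-true ((p , w) Q.≼? y₀) (≼y₀ p))
                                         (cong not (does-iff ((p , w) Q.≟ y₀) (p FinP.≟ bot) (cong proj₁) (cong (_, w))))))
                        (regroup (inQ? (p , w)) (does (m₀ Q.≼? (p , w))) (not (does (p FinP.≟ bot))) (μQ m₀ (p , w)))
      where
      regroup : ∀ a b c (v : ℤ) → guard (a ∧ b ∧ true ∧ c) v ≡ guard c (guard (a ∧ b) v)
      regroup true  true  c     v = refl
      regroup true  false true  v = refl
      regroup true  false false v = refl
      regroup false b     true  v = refl
      regroup false b     false v = refl

    term : Fin size → ℕ → ℤ
    term p ℓ = guard (inQ? (p , take ℓ w) ∧ halfOpen Q m₀ y₀ (p , take ℓ w)) (μQ m₀ (p , take ℓ w))

    split-length : ∀ p ℓ → guard (does (ℓ ℕP.≤? length w)) (term p ℓ) ≡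
                           guard (does (ℓ ℕP.<? length w)) (term p ℓ) ⊕ guard (does (ℓ ℕP.≟ length w)) (term p ℓ)
    split-length p ℓ = trans
      (cong (λ c → guard c (term p ℓ))
            (does-iff (ℓ ℕP.≤? length w) ((ℓ ℕP.<? length w) ⊎-dec (ℓ ℕP.≟ length w))
                      ℕP.m≤n⇒m<n∨m≡n [ ℕP.<⇒≤ , ℕP.≤-reflexive ]′))
      (guard-∨ _ _ (term p ℓ) (λ ℓ<|w| → dec-false (ℓ ℕP.≟ length w) (ℕP.<⇒≢ (witness (ℓ ℕP.<? length w) ℓ<|w|))))

    full-length : ∀ p → sumOver (upTo (suc n)) (λ ℓ → guard (does (ℓ ℕP.≟ length w)) (term p ℓ)) ≡
                        guard (not (does (p FinP.≟ bot))) (μFromBase p w)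
    full-length p = begin
      sumOver (upTo (suc n)) (λ ℓ → guard (does (ℓ ℕP.≟ length w)) (term p ℓ))
        ≡⟨ sumOver-point′ (upTo (suc n)) (length w) (term p) (upTo⁺ (suc n)) (∈-upTo⁺ (s≤s |w|≤n)) ⟩
      term p (length w)
        ≡⟨ cong (λ v → guard (inQ? (p , v) ∧ halfOpen Q m₀ y₀ (p , v)) (μQ m₀ (p , v)))
                (ListP.take-all (length w) w ℕP.≤-refl) ⟩
      guard (inQ? (p , w) ∧ halfOpen Q m₀ y₀ (p , w)) (μQ m₀ (p , w))
        ≡⟨ same-word p ⟩
      guard (not (does (p FinP.≟ bot))) (μFromBase p w) ∎
      where open PointSums ℕP._≟_ renaming (sumOver-point to sumOver-point′)

    recursion-at-bot : μQ m₀ y₀ ≡ - (shorterSum w ⊕ others)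
    recursion-at-bot = begin
      μQ m₀ y₀
        ≡⟨ Qμ.μ-recursion m₀ y₀ m₀∈Q y₀∈Q m₀≼y₀ (λ e → top≢bot (cong proj₁ e)) ⟩
      - sumWhere (halfOpen Q m₀ y₀) (μQ m₀) Q.elems
        ≡⟨ cong -_ (halfOpenSum bot w (μQ m₀)) ⟩
      - sumOver (allFin size) (λ p → sumOver (upTo (suc n)) (λ ℓ → guard (does (ℓ ℕP.≤? length w)) (term p ℓ)))
        ≡⟨ cong -_ (sumOver-cong (allFin size) (λ p → trans (sumOver-cong (upTo (suc n)) (split-length p))
                                                            (sumOver-+ (upTo (suc n)) (λ ℓ → guard (does (ℓ ℕP.<? length w)) (term p ℓ))
                                                                                      (λ ℓ → guard (does (ℓ ℕP.≟ length w)) (term p ℓ))))) ⟩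
      - sumOver (allFin size) (λ p → sumOver (upTo (suc n)) (λ ℓ → guard (does (ℓ ℕP.<? length w)) (term p ℓ))
                                   ⊕ sumOver (upTo (suc n)) (λ ℓ → guard (does (ℓ ℕP.≟ length w)) (term p ℓ)))
        ≡⟨ cong -_ (trans (sumOver-+ (allFin size) _ _)
                          (cong (_⊕_ (shorterSum w)) (sumOver-cong (allFin size) full-length))) ⟩
      - (shorterSum w ⊕ others) ∎

    split-at-bot : wordSum w ≡ μFromBase bot w ⊕ others
    split-at-bot = begin
      wordSum w
        ≡⟨ sumOver-cong (allFin size) (λ p → split (does (p FinP.≟ bot)) (μFromBase p w)) ⟩
      sumOver (allFin size) (λ p → guard (does (p FinP.≟ bot)) (μFromBase p w) ⊕ guard (not (does (p FinP.≟ bot))) (μFromBase p w))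
        ≡⟨ sumOver-+ (allFin size) _ _ ⟩
      sumOver (allFin size) (λ p → guard (does (p FinP.≟ bot)) (μFromBase p w)) ⊕ others
        ≡⟨ cong (_⊕ others) (PointSums.sumOver-point FinP._≟_ (allFin size) bot (λ p → μFromBase p w) (allFin⁺ size) (∈-allFin bot)) ⟩
      μFromBase bot w ⊕ others ∎
      where
      split : ∀ b (v : ℤ) → v ≡ guard b v ⊕ guard (not b) v
      split true  v = sym (ℤP.+-identityʳ v)
      split false v = sym (ℤP.+-identityˡ v)

    -- Comparing with the recursion for μ_Q(m₀, (0̂, w)) leaves only the shorter words.
    wordSum-recursion : wordSum w ≡ - shorterSum w
    wordSum-recursion = begin
      wordSum w                            ≡⟨ split-at-bot ⟩
      μFromBase bot w ⊕ others             ≡⟨ cong (_⊕ others) (trans μFromBase-bot recursion-at-bot) ⟩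
      - (shorterSum w ⊕ others) ⊕ others   ≡⟨ cancel (shorterSum w) others ⟩
      - shorterSum w                       ∎
      where
      cancel : ∀ a b → - (a ⊕ b) ⊕ b ≡ - a
      cancel a b = begin
        - (a ⊕ b) ⊕ b     ≡⟨ cong (_⊕ b) (ℤP.neg-distrib-+ a b) ⟩
        - a ⊕ - b ⊕ b     ≡⟨ ℤP.+-assoc (- a) (- b) b ⟩
        - a ⊕ (- b ⊕ b)   ≡⟨ cong (_⊕_ (- a)) (ℤP.+-inverseˡ b) ⟩
        - a ⊕ + 0         ≡⟨ ℤP.+-identityʳ (- a) ⟩
        - a               ∎

  wordSum≡-shorterSum : ∀ w → w ∈ treeVertices t → length w ≤ n → ¬ top ≡ bot → wordSum w ≡ - shorterSum w
  wordSum≡-shorterSum = WordRecursion.wordSum-recursion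

  -- The root has no shorter words, so the words of length 0 contribute nothing.
  levelSum-zero : ¬ top ≡ bot → levelSum 0 ≡ + 0
  levelSum-zero top≢bot = begin
    wordSum [] ⊕ + 0 ≡⟨ ℤP.+-identityʳ _ ⟩
    wordSum []       ≡⟨ wordSum≡-shorterSum [] (here refl) z≤n top≢bot ⟩
    - shorterSum []  ≡⟨ cong -_ (trans (sumOver-cong (allFin size) (λ p → sumOver-zero (upTo (suc n))))
                                       (sumOver-zero (allFin size))) ⟩
    + 0 ∎
    where open ≡-Reasoning

-- Fix a word w of length k = j + 1.  The map φ(p, i) = (p, w↾(j - i)) sends the
-- ideal I_j(P) order-reversingly onto the elements of [m₀, (0̂, w)) carrying a
-- word shorter than w, and extends to Î_j(P) by 1̂ ↦ m₀, 0̂ ↦ (0̂, w).  Both sides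
-- are described by the same conditions on ranks in P (`Precedes`, `InIdeal`);
-- transporting μ along φ then shows shorterSum w = -μ(Î_j(P)).
module ShorterWords (P : BoundedRankedPoset) (t : ℕ)
    (1≤n : 1 ≤ BoundedRankedPoset.len P) (j : Fin (BoundedRankedPoset.len P))
    (w : TreeWords.Word P t) (|w|≡k : length w ≡ suc (toℕ j))
    (w∈T : w ∈ Constructions.treeVertices P t) where

  open import Data.Nat using (_<_; _∸_; _+_; _<ᵇ_; z≤n; s≤s)
  import Data.Nat.Properties as ℕP
  open import Data.Integer using (+_) renaming (_+_ to _⊕_)
  import Data.Integer.Properties as ℤP
  import Data.Fin.Properties as FinP
  open import Data.List using (List; map; concatMap; allFin; upTo; take)
  import Data.List.Properties as ListP
  open import Data.List.Membership.Propositional.Properties using (∈-allFin; ∈-upTo⁺; ∈-map⁻)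
  open import Data.List.Relation.Unary.Any using (here; there)
  open import Data.List.Relation.Unary.Unique.Propositional using (Unique)
  open import Data.List.Relation.Unary.Unique.Propositional.Properties using (allFin⁺; upTo⁺)
  open import Data.List.Relation.Binary.Prefix.Heterogeneous using (Prefix; [])
  open import Data.Bool using (Bool; true; false; _∧_; not)
  open import Data.Sum using (_⊎_; inj₁; inj₂)
  open import Data.Product using (_×_; _,_; proj₁; proj₂)
  open import Function.Bundles using (_⇔_; mk⇔; module Equivalence)
  open import Relation.Nullary using (Dec; yes; no; does; ¬_; contradiction)
  open import Relation.Nullary.Decidable using (dec-true; dec-false; _×-dec_; _⊎-dec_; ¬?)
  open import Relation.Binary.Structures using (IsPartialOrder)
  open import Relation.Binary.PropositionalEquality using (refl; cong; cong₂; sym; trans; subst; subst₂; module ≡-Reasoning)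
  open BoundedRankedPoset P
  open Constructions P
  open RankedPosets P using (rk≤len; rk-pos) renaming (isPartialOrder to P-isPartialOrder)
  open TreeWords P t
  open ReesTree P t
  open FiniteSums
  open Decisions
  open MöbiusFunction
  open OrderConstructions
  open ReesArithmetic
  open Equivalence

  j' k : ℕ
  j' = toℕ j
  k  = suc j'

  k≤n : k ≤ n
  k≤n = FinP.toℕ<n j

  length-take : ∀ {ℓ} → ℓ ≤ k → length (take ℓ w) ≡ ℓ
  length-take {ℓ} ℓ≤k = trans (ListP.length-take ℓ w) (ℕP.m≤n⇒m⊓n≡m (subst (ℓ ≤_) (sym |w|≡k) ℓ≤k))

  lengthOf : ℕ → ℕ
  lengthOf a = j' ∸ a

  index+length : ∀ a → a ≤ j' → a + lengthOf a ≡ j'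
  index+length a a≤j = ℕP.m+[n∸m]≡n a≤j

  -- (p, ℓ) describes a point (p, w↾ℓ) of Q and, for ℓ < k, the point (p, j - ℓ)
  -- of P⁻ ∗ C_n.  Both are elements of the respective intervals exactly when:
  InIdeal : Fin size → ℕ → Set
  InIdeal p ℓ = k ≤ rk p + ℓ × ℓ + rk p ≤ n × ¬ (p ≡ top × ℓ ≡ 0)

  -- (p, w↾ℓ) < (q, w↾ℓ') in Q, equivalently (q, j-ℓ') < (p, j-ℓ) in P⁻ ∗ C_n:
  Precedes : Fin size → ℕ → Fin size → ℕ → Set
  Precedes q ℓ' p ℓ = q ≤P p × ℓ ≤ ℓ' × ℓ' + rk q ≤ rk p + ℓ × ¬ (p ≡ q × ℓ ≡ ℓ')

  -- (p, ℓ) describes m₀.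
  isBase : Fin size → ℕ → Set
  isBase p ℓ = p ≡ top × ℓ ≡ 0

  isBase? : ∀ p ℓ → Dec (isBase p ℓ)
  isBase? p ℓ = (p FinP.≟ top) ×-dec (ℓ ℕP.≟ 0)

  InIdeal? : ∀ p ℓ → Dec (InIdeal p ℓ)
  InIdeal? p ℓ = (k ℕP.≤? rk p + ℓ) ×-dec (ℓ + rk p ℕP.≤? n) ×-dec ¬? (isBase? p ℓ)

  Precedes? : ∀ q ℓ' p ℓ → Dec (Precedes q ℓ' p ℓ)
  Precedes? q ℓ' p ℓ = (q ≤P? p) ×-dec (ℓ ℕP.≤? ℓ') ×-dec (ℓ' + rk q ℕP.≤? rk p + ℓ) ×-dec
                       ¬? ((p FinP.≟ q) ×-dec (ℓ ℕP.≟ ℓ'))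

  -- Strictly between the anchor (q, ℓ') and m₀, with a word shorter than w.
  Between : Fin size → ℕ → Fin size → ℕ → Set
  Between q ℓ' p ℓ = ℓ < k × InIdeal p ℓ × Precedes q ℓ' p ℓ

  Between? : ∀ q ℓ' p ℓ → Dec (Between q ℓ' p ℓ)
  Between? q ℓ' p ℓ = (ℓ ℕP.<? k) ×-dec InIdeal? p ℓ ×-dec Precedes? q ℓ' p ℓ

  -- An anchor (q, ℓ') stands for the point (q, w↾ℓ') ∈ [m₀, (0̂, w)], other than m₀.
  record Anchor (q : Fin size) (ℓ' : ℕ) : Set where
    field
      ℓ'≤k   : ℓ' ≤ k
      k≤     : k ≤ rk q + ℓ'
      ≤n     : ℓ' + rk q ≤ n
      notBase : ¬ isBase q ℓ'

  inShortInterval : Fin size → ℕ → Fin size → ℕ → Bool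
  inShortInterval q ℓ' p ℓ = does (ℓ ℕP.<? k) ∧ does (ℓ ℕP.≤? ℓ') ∧
                             inQ? (p , take ℓ w) ∧ halfOpen Q m₀ (q , take ℓ' w) (p , take ℓ w)

  ShortInterval : Fin size → ℕ → Fin size → ℕ → Set
  ShortInterval q ℓ' p ℓ = ℓ < k × ℓ ≤ ℓ' × length (take ℓ w) ≤ rkDual p ×
                           m₀ Q.≼ (p , take ℓ w) × (p , take ℓ w) Q.≼ (q , take ℓ' w) × ¬ (p , take ℓ w) ≡ (q , take ℓ' w)

  ShortInterval? : ∀ q ℓ' p ℓ → Dec (ShortInterval q ℓ' p ℓ)
  ShortInterval? q ℓ' p ℓ =
    (ℓ ℕP.<? k) ×-dec (ℓ ℕP.≤? ℓ') ×-dec (length (take ℓ w) ℕP.≤? rkDual p) ×-dec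
    (m₀ Q.≼? (p , take ℓ w)) ×-dec ((p , take ℓ w) Q.≼? (q , take ℓ' w)) ×-dec ¬? ((p , take ℓ w) Q.≟ (q , take ℓ' w))

  -- Q side: the short part of [m₀, (q, w↾ℓ')) consists of m₀ and the points
  -- between the anchor and m₀, translating the rank conditions of Q into P.
  module ShortIntervalAt {q : Fin size} {ℓ' : ℕ} (a : Anchor q ℓ') (p : Fin size) (ℓ : ℕ) where
    open Anchor a
    |u| : length (take ℓ' w) ≡ ℓ'
    |u| = length-take ℓ'≤k
    toBetween : ShortInterval q ℓ' p ℓ → Between q ℓ' p ℓ ⊎ isBase p ℓ
    toBetween (ℓ<k , ℓ≤ℓ' , |v|≤ , _ , (q≤p , _ , rank≤) , v≢u) with isBase? p ℓ
    ... | yes base   = inj₂ base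
    ... | no notBase′ = inj₁ (ℓ<k , (k≤rk+ℓ , ℓ+rk≤n , notBase′) , (q≤p , ℓ≤ℓ' , ranks , distinct))
      where
      |v| : length (take ℓ w) ≡ ℓ
      |v| = length-take (ℕP.≤-trans ℓ≤ℓ' ℓ'≤k)
      ℓ+rk≤n : ℓ + rk p ≤ n
      ℓ+rk≤n = to (dualRank⇔ ℓ (rk p) n (rk≤len p)) (subst (_≤ rkDual p) |v| |v|≤)
      ranks : ℓ' + rk q ≤ rk p + ℓ
      ranks = to (dualRees⇔ ℓ ℓ' (rk p) (rk q) n (rk≤len p) (rk≤len q))
                 (subst₂ (λ a b → a + rkDual p ≤ rkDual q + b) |u| |v| rank≤)
      k≤rk+ℓ : k ≤ rk p + ℓ
      k≤rk+ℓ = ℕP.≤-trans k≤ (ℕP.≤-trans (ℕP.≤-reflexive (ℕP.+-comm (rk q) ℓ')) ranks)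
      distinct : ¬ (p ≡ q × ℓ ≡ ℓ')
      distinct (refl , refl) = v≢u refl
    fromBetween : Between q ℓ' p ℓ ⊎ isBase p ℓ → ShortInterval q ℓ' p ℓ
    fromBetween (inj₁ (ℓ<k , (_ , ℓ+rk≤n , _) , (q≤p , ℓ≤ℓ' , ranks , distinct))) =
      ℓ<k , ℓ≤ℓ' , |v|≤ , (top-max p , [] , above) , (q≤p , prefix , rank≤) , v≢u
      where
      |v| : length (take ℓ w) ≡ ℓ
      |v| = length-take (ℕP.≤-trans ℓ≤ℓ' ℓ'≤k)
      |v|≤ : length (take ℓ w) ≤ rkDual p
      |v|≤ = subst (_≤ rkDual p) (sym |v|) (from (dualRank⇔ ℓ (rk p) n (rk≤len p)) ℓ+rk≤n)
      above : length (take ℓ w) + rkDual top ≤ rkDual p + 0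
      above = subst (λ a → a + rkDual top ≤ rkDual p + 0) (sym |v|) (from (aboveBase⇔ ℓ (rk p) n (rk≤len p)) ℓ+rk≤n)
      prefix : Prefix _≡_ (take ℓ w) (take ℓ' w)
      prefix = subst (λ v → Prefix _≡_ v (take ℓ' w)) (take-shorter w ℓ≤ℓ') (take-prefix ℓ (take ℓ' w))
      rank≤ : length (take ℓ' w) + rkDual p ≤ rkDual q + length (take ℓ w)
      rank≤ = subst₂ (λ a b → a + rkDual p ≤ rkDual q + b) (sym |u|) (sym |v|)
                (from (dualRees⇔ ℓ ℓ' (rk p) (rk q) n (rk≤len p) (rk≤len q)) ranks)
      v≢u : ¬ (p , take ℓ w) ≡ (q , take ℓ' w)
      v≢u e = distinct (cong proj₁ e , trans (sym |v|) (trans (cong (λ z → length (proj₂ z)) e) |u|))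
    fromBetween (inj₂ (refl , refl)) =
      s≤s z≤n , z≤n , z≤n , (IsPartialOrder.refl Q-isPartialOrder) ,
      (top-max q , [] , subst (λ a → a + rkDual top ≤ rkDual q + 0) (sym |u|)
                                (from (aboveBase⇔ ℓ' (rk q) n (rk≤len q)) ≤n)) ,
      λ e → notBase (sym (cong proj₁ e) , trans (sym |u|) (sym (cong (λ z → length (proj₂ z)) e)))

  inShortInterval⇔ : ∀ q ℓ' → Anchor q ℓ' → ∀ p ℓ →
    inShortInterval q ℓ' p ℓ ≡ does (Between? q ℓ' p ℓ ⊎-dec isBase? p ℓ)
  inShortInterval⇔ q ℓ' a p ℓ =
    does-iff (ShortInterval? q ℓ' p ℓ) (Between? q ℓ' p ℓ ⊎-dec isBase? p ℓ) toBetween fromBetween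
    where open ShortIntervalAt a p ℓ

  R : FinOrd
  R = reesMinusChain
  module R = FinOrd R

  I Î : FinOrd
  I = idealI j
  Î = hat I
  module I = FinOrd I
  module Î = FinOrd Î

  T : R.Carrier
  T = (top , j)

  inR? : R.Carrier → Bool
  inR? (p , i) = not (does (p FinP.≟ bot)) ∧ does (toℕ i ℕP.≤? rkMinus p)

  belowT? : R.Carrier → Bool
  belowT? z = does (z R.≼? T) ∧ not (does (z R.≟ T))

  -- mid (p, i) ∈ (y, 1̂] in Î, i.e. in the half-open interval [1̂, y) of Î*.
  inUpper : Hat R.Carrier → Fin size → Fin n → Bool
  inUpper y p i = inR? (p , i) ∧ belowT? (p , i) ∧ halfOpen (dual Î) htop y (mid (p , i))

  InR BelowT : Fin size → Fin n → Set
  InR p i    = ¬ p ≡ bot × toℕ i ≤ rkMinus p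
  BelowT p i = (p , i) R.≼ T × ¬ (p , i) ≡ T

  Upper : Hat R.Carrier → Fin size → Fin n → Set
  Upper y p i = InR p i × BelowT p i × (mid (p , i) Î.≼ htop × (y Î.≼ mid (p , i) × ¬ mid (p , i) ≡ y))

  Upper? : ∀ y p i → Dec (Upper y p i)
  Upper? y p i = (¬? (p FinP.≟ bot) ×-dec (toℕ i ℕP.≤? rkMinus p)) ×-dec (((p , i) R.≼? T) ×-dec ¬? ((p , i) R.≟ T))
                 ×-dec ((mid (p , i) Î.≼? htop) ×-dec ((y Î.≼? mid (p , i)) ×-dec ¬? (mid (p , i) Î.≟ y)))

  nonzero-rank : ∀ {p} → 1 ≤ rk p → ¬ p ≡ bot
  nonzero-rank {p} 1≤rk refl = ℕP.<⇒≱ 1≤rk (ℕP.≤-reflexive rk-bot)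

  inIdeal⇔ : ∀ p i → (InR p i × BelowT p i) ⇔ (toℕ i < k × InIdeal p (lengthOf (toℕ i)))
  inIdeal⇔ p i = mk⇔ to-P from-P
    where
    a = toℕ i
    ℓ = lengthOf a
    to-P : InR p i × BelowT p i → toℕ i < k × InIdeal p ℓ
    to-P ((p≢bot , a≤) , ((_ , a≤j , rank≤) , ≢T)) = s≤s a≤j , k≤rk+ℓ , ℓ+rk≤n , notBase
      where
      a+ℓ = index+length a a≤j
      1≤rk = rk-pos p≢bot
      k≤rk+ℓ : k ≤ rk p + ℓ
      k≤rk+ℓ = subst (_≤ rk p + ℓ) (cong suc a+ℓ) (to (chainRank⇔ a ℓ _ (rk p) refl) (1≤rk , a≤))
      ℓ+rk≤n : ℓ + rk p ≤ n
      ℓ+rk≤n = to (belowTop⇔ a ℓ j' (rk p) n a+ℓ 1≤rk 1≤n) rank≤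
      notBase : ¬ isBase p ℓ
      notBase (refl , ℓ≡0) = ≢T (cong (p ,_) (FinP.toℕ-injective (from (chainTop⇔ a ℓ j' a+ℓ) ℓ≡0)))
    from-P : toℕ i < k × InIdeal p ℓ → InR p i × BelowT p i
    from-P (s≤s a≤j , k≤rk+ℓ , ℓ+rk≤n , notBase) =
      (nonzero-rank 1≤rk , a≤) , ((top-max p , a≤j , from (belowTop⇔ a ℓ j' (rk p) n a+ℓ 1≤rk 1≤n) ℓ+rk≤n) , ≢T)
      where
      a+ℓ = index+length a a≤j
      ranks = from (chainRank⇔ a ℓ _ (rk p) refl) (subst (_≤ rk p + ℓ) (sym (cong suc a+ℓ)) k≤rk+ℓ)
      1≤rk = proj₁ ranks
      a≤ = proj₂ ranks
      ≢T : ¬ (p , i) ≡ T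
      ≢T e = notBase (cong proj₁ e , to (chainTop⇔ a ℓ j' a+ℓ) (cong (λ z → toℕ (proj₂ z)) e))

  lengthOf<k : ∀ a → lengthOf a < k
  lengthOf<k a = s≤s (ℕP.m∸n≤m j' a)

  -- An element mid (q, i') of the open interval (0̂, 1̂) of Î, seen as an anchor.
  record InteriorPoint (q : Fin size) (i' : Fin n) : Set where
    field
      inR     : InR q i'
      belowT  : BelowT q i'

    a' ℓ' : ℕ
    a' = toℕ i'
    ℓ' = lengthOf a'

    a'+ℓ' : a' + ℓ' ≡ j'
    a'+ℓ' = index+length a' (proj₁ (proj₂ (proj₁ belowT)))

    1≤rk : 1 ≤ rk q
    1≤rk = rk-pos (proj₁ inR)

    anchor : Anchor q ℓ'
    anchor = let (_ , k≤ , ≤n , notBase) = to (inIdeal⇔ q i') (inR , belowT) in record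
      { ℓ'≤k = ℕP.<⇒≤ (lengthOf<k a') ; k≤ = k≤ ; ≤n = ≤n ; notBase = notBase }

  upper-interior⇔ : ∀ q i' → (y : InteriorPoint q i') → let open InteriorPoint y in ∀ p i →
    Upper (mid (q , i')) p i ⇔ (toℕ i < k × Between q ℓ' p (lengthOf (toℕ i)))
  upper-interior⇔ q i' y p i = mk⇔ to-P from-P
    where
    open InteriorPoint y
    a = toℕ i
    ℓ = lengthOf a
    to-P : Upper (mid (q , i')) p i → toℕ i < k × Between q ℓ' p ℓ
    to-P (inR-p , belowT-p , _ , mid≤ (q≤p , a'≤a , rank≤) , ≢y) =
      a<k , lengthOf<k a , inIdeal , (q≤p , to (chainOrder⇔ a ℓ a' ℓ' j' a+ℓ a'+ℓ') a'≤a ,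
                                       to (chainRees⇔ a ℓ a' ℓ' j' (rk p) (rk q) a+ℓ a'+ℓ' (rk-pos (proj₁ inR-p)) 1≤rk) rank≤ ,
                                       distinct)
      where
      a<k×inIdeal = to (inIdeal⇔ p i) (inR-p , belowT-p)
      a<k = proj₁ a<k×inIdeal
      inIdeal = proj₂ a<k×inIdeal
      a+ℓ = index+length a (ℕP.≤-pred a<k)
      distinct : ¬ (p ≡ q × ℓ ≡ ℓ')
      distinct (refl , ℓ≡ℓ') = ≢y (cong (λ x → mid (p , x)) (FinP.toℕ-injective (from (chainEq⇔ a ℓ a' ℓ' j' a+ℓ a'+ℓ') ℓ≡ℓ')))
    from-P : toℕ i < k × Between q ℓ' p ℓ → Upper (mid (q , i')) p i
    from-P (a<k , _ , inIdeal , (q≤p , ℓ≤ℓ' , ranks , distinct)) =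
      inR-p , belowT-p , ≤top ,
      mid≤ (q≤p , from (chainOrder⇔ a ℓ a' ℓ' j' a+ℓ a'+ℓ') ℓ≤ℓ' ,
            from (chainRees⇔ a ℓ a' ℓ' j' (rk p) (rk q) a+ℓ a'+ℓ' (rk-pos (proj₁ inR-p)) 1≤rk) ranks) ,
      ≢y
      where
      inR×belowT = from (inIdeal⇔ p i) (a<k , inIdeal)
      inR-p = proj₁ inR×belowT
      belowT-p = proj₂ inR×belowT
      a+ℓ = index+length a (ℕP.≤-pred a<k)
      ≢y : ¬ mid (p , i) ≡ mid (q , i')
      ≢y refl = distinct (refl , refl)

  -- The bottom (0̂, w) of the short part corresponds to 0̂ of Î, anchored at (0̂, k).
  anchor-bot : Anchor bot k
  anchor-bot = record
    { ℓ'≤k = ℕP.≤-refl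
    ; k≤ = subst (λ r → k ≤ r + k) (sym rk-bot) ℕP.≤-refl
    ; ≤n = subst (λ r → k + r ≤ n) (sym rk-bot) (subst (_≤ n) (sym (ℕP.+-identityʳ k)) k≤n)
    ; notBase = λ { (_ , ()) } }

  upper-bot⇔ : ∀ p i → Upper hbot p i ⇔ (toℕ i < k × Between bot k p (lengthOf (toℕ i)))
  upper-bot⇔ p i = mk⇔ to-P from-P
    where
    ℓ = lengthOf (toℕ i)
    to-P : Upper hbot p i → toℕ i < k × Between bot k p ℓ
    to-P (inR-p , belowT-p , _) =
      a<k , lengthOf<k (toℕ i) , inIdeal ,
      (bot-min p , ℕP.<⇒≤ (lengthOf<k (toℕ i)) ,
       subst (λ r → k + r ≤ rk p + ℓ) (sym rk-bot) (subst (_≤ rk p + ℓ) (sym (ℕP.+-identityʳ k)) (proj₁ inIdeal)) ,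
       λ (_ , ℓ≡k) → ℕP.<-irrefl ℓ≡k (lengthOf<k (toℕ i)))
      where
      a<k×inIdeal = to (inIdeal⇔ p i) (inR-p , belowT-p)
      a<k = proj₁ a<k×inIdeal
      inIdeal = proj₂ a<k×inIdeal
    from-P : toℕ i < k × Between bot k p ℓ → Upper hbot p i
    from-P (a<k , _ , inIdeal , _) =
      let (inR-p , belowT-p) = from (inIdeal⇔ p i) (a<k , inIdeal) in inR-p , belowT-p , ≤top , bot≤ , λ ()

  baseSum : (G : Fin size → ℕ → ℤ) →
    sumOver (allFin size) (λ p → sumOver (upTo (suc n)) (λ ℓ → guard (does (isBase? p ℓ)) (G p ℓ))) ≡ G top 0
  baseSum G = begin
    sumOver (allFin size) (λ p → sumOver (upTo (suc n)) (λ ℓ → guard (does (isBase? p ℓ)) (G p ℓ)))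
      ≡⟨ sumOver-cong (allFin size) (λ p → trans
           (sumOver-cong (upTo (suc n)) (λ ℓ → guard-∧ (does (p FinP.≟ top)) (does (ℓ ℕP.≟ 0)) (G p ℓ)))
           (sumOver-guard (does (p FinP.≟ top)) (upTo (suc n)) _)) ⟩
    sumOver (allFin size) (λ p → guard (does (p FinP.≟ top)) (sumOver (upTo (suc n)) (λ ℓ → guard (does (ℓ ℕP.≟ 0)) (G p ℓ))))
      ≡⟨ PointSums.sumOver-point FinP._≟_ (allFin size) top _ (allFin⁺ size) (∈-allFin top) ⟩
    sumOver (upTo (suc n)) (λ ℓ → guard (does (ℓ ℕP.≟ 0)) (G top ℓ))
      ≡⟨ PointSums.sumOver-point ℕP._≟_ (upTo (suc n)) 0 (G top) (upTo⁺ (suc n)) (∈-upTo⁺ (s≤s z≤n)) ⟩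
    G top 0 ∎
    where open ≡-Reasoning

  betweenSum-by-index : ∀ q ℓ' (upper : Fin size → Fin n → Bool) →
    (∀ p i → upper p i ≡ does ((toℕ i ℕP.<? k) ×-dec Between? q ℓ' p (lengthOf (toℕ i)))) →
    (G : Fin size → ℕ → ℤ) → ∀ p →
    sumOver (allFin n) (λ i → guard (upper p i) (G p (lengthOf (toℕ i)))) ≡
    sumOver (upTo (suc n)) (λ ℓ → guard (does (Between? q ℓ' p ℓ)) (G p ℓ))
  betweenSum-by-index q ℓ' upper upper≡ G p = begin
    sumOver (allFin n) (λ i → guard (upper p i) (G p (lengthOf (toℕ i))))
      ≡⟨ sumOver-cong (allFin n) (λ i → trans (cong (λ b → guard b (G p (lengthOf (toℕ i)))) (upper≡ p i))
                                             (guard-∧ (toℕ i <ᵇ k) _ _)) ⟩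
    sumOver (allFin n) (λ i → guard (toℕ i <ᵇ k) (F (k ∸ 1 ∸ toℕ i)))
      ≡⟨ reflect-segment n k F k≤n ⟩
    sumOver (upTo (suc n)) (λ ℓ → guard (ℓ <ᵇ k) (F ℓ))
      ≡⟨ sumOver-cong (upTo (suc n)) (λ ℓ → guard-implied (ℓ <ᵇ k) _ (G p ℓ)
           (λ e → dec-true (ℓ ℕP.<? k) (proj₁ (witness (Between? q ℓ' p ℓ) e)))) ⟩
    sumOver (upTo (suc n)) (λ ℓ → guard (does (Between? q ℓ' p ℓ)) (G p ℓ)) ∎
    where
    open ≡-Reasoning
    open SegmentSums using (reflect-segment)
    F : ℕ → ℤ
    F ℓ = guard (does (Between? q ℓ' p ℓ)) (G p ℓ)

  shortIntervalSum : ∀ q ℓ' → Anchor q ℓ' → (upper : Fin size → Fin n → Bool) →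
    (∀ p i → upper p i ≡ does ((toℕ i ℕP.<? k) ×-dec Between? q ℓ' p (lengthOf (toℕ i)))) →
    (G : Fin size → ℕ → ℤ) →
    sumOver (allFin size) (λ p → sumOver (upTo (suc n)) (λ ℓ → guard (inShortInterval q ℓ' p ℓ) (G p ℓ)))
    ≡ G top 0 ⊕ sumOver (allFin size) (λ p → sumOver (allFin n) (λ i → guard (upper p i) (G p (lengthOf (toℕ i)))))
  shortIntervalSum q ℓ' anchor upper upper≡ G = begin
    sumOver (allFin size) (λ p → sumOver (upTo (suc n)) (λ ℓ → guard (inShortInterval q ℓ' p ℓ) (G p ℓ)))
      ≡⟨ sumOver-cong (allFin size) (λ p → trans (sumOver-cong (upTo (suc n)) (split p))
           (sumOver-+ (upTo (suc n)) (λ ℓ → guard (does (Between? q ℓ' p ℓ)) (G p ℓ))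
                                     (λ ℓ → guard (does (isBase? p ℓ)) (G p ℓ)))) ⟩
    sumOver (allFin size) (λ p → between p ⊕ base p)
      ≡⟨ sumOver-+ (allFin size) between base ⟩
    sumOver (allFin size) between ⊕ sumOver (allFin size) base
      ≡⟨ cong₂ _⊕_ (sumOver-cong (allFin size) (λ p → sym (betweenSum-by-index q ℓ' upper upper≡ G p))) (baseSum G) ⟩
    sumOver (allFin size) (λ p → sumOver (allFin n) (λ i → guard (upper p i) (G p (lengthOf (toℕ i))))) ⊕ G top 0
      ≡⟨ ℤP.+-comm _ (G top 0) ⟩
    G top 0 ⊕ sumOver (allFin size) (λ p → sumOver (allFin n) (λ i → guard (upper p i) (G p (lengthOf (toℕ i))))) ∎
    where
    open ≡-Reasoning
    between base : Fin size → ℤ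
    between p = sumOver (upTo (suc n)) (λ ℓ → guard (does (Between? q ℓ' p ℓ)) (G p ℓ))
    base p    = sumOver (upTo (suc n)) (λ ℓ → guard (does (isBase? p ℓ)) (G p ℓ))

    split : ∀ p ℓ → guard (inShortInterval q ℓ' p ℓ) (G p ℓ) ≡
                    guard (does (Between? q ℓ' p ℓ)) (G p ℓ) ⊕ guard (does (isBase? p ℓ)) (G p ℓ)
    split p ℓ = trans (cong (λ b → guard b (G p ℓ)) (inShortInterval⇔ q ℓ' anchor p ℓ))
                      (guard-∨ _ _ (G p ℓ) (λ e → dec-false (isBase? p ℓ)
                                               (proj₂ (proj₂ (proj₁ (proj₂ (witness (Between? q ℓ' p ℓ) e)))))))

  R-isPartialOrder : IsPartialOrder _≡_ R._≼_
  R-isPartialOrder = rees-isPartialOrder {rA = rkMinus} {rB = toℕ} P-isPartialOrder FinP.≤-isPartialOrder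

  Î-isPartialOrder : IsPartialOrder _≡_ Î._≼_
  Î-isPartialOrder = hat-isPartialOrder R-isPartialOrder

  Î-unique : Unique Î.elems
  Î-unique = hat-unique I (unique-filterB belowT? (unique-filterB inR? (pairs-unique (allFin⁺ size) (allFin⁺ n))))

  module ÎDuality = Duality Î Î-isPartialOrder Î-unique
  module Î* = ÎDuality.R

  upperSum : ∀ y (h : Î.Carrier → ℤ) →
    halfOpen (dual Î) htop y hbot ≡ false → halfOpen (dual Î) htop y htop ≡ true →
    sumWhere (halfOpen (dual Î) htop y) h Î.elems ≡
    h htop ⊕ sumOver (allFin size) (λ p → sumOver (allFin n) (λ i → guard (inUpper y p i) (h (mid (p , i)))))
  upperSum y h bot-out top-in rewrite bot-out | top-in = cong (_⊕_ (h htop)) (begin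
    sumWhere (halfOpen (dual Î) htop y) h (map mid I.elems)
      ≡⟨ sumWhere-map (halfOpen (dual Î) htop y) h mid I.elems ⟩
    sumWhere (λ z → halfOpen (dual Î) htop y (mid z)) (λ z → h (mid z)) I.elems
      ≡⟨ sumWhere≡sumOver _ _ I.elems ⟩
    sumOver (filterB belowT? R.elems) (λ z → guard (halfOpen (dual Î) htop y (mid z)) (h (mid z)))
      ≡⟨ sumOver-filterB belowT? R.elems _ ⟩
    sumOver (filterB inR? R-candidates) (λ z → guard (belowT? z) (guard (halfOpen (dual Î) htop y (mid z)) (h (mid z))))
      ≡⟨ sumOver-filterB inR? R-candidates _ ⟩
    sumOver R-candidates (λ z → guard (inR? z) (guard (belowT? z) (guard (halfOpen (dual Î) htop y (mid z)) (h (mid z)))))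
      ≡⟨ sumOver-concatMap (λ p → map (p ,_) (allFin n)) (allFin size) _ ⟩
    sumOver (allFin size) (λ p → sumOver (map (p ,_) (allFin n)) (λ z → guard (inR? z) (guard (belowT? z) (guard (halfOpen (dual Î) htop y (mid z)) (h (mid z))))))
      ≡⟨ sumOver-cong (allFin size) (λ p → trans (sumOver-map (p ,_) (allFin n) _)
           (sumOver-cong (allFin n) (λ i → sym (regroup (p , i))))) ⟩
    sumOver (allFin size) (λ p → sumOver (allFin n) (λ i → guard (inUpper y p i) (h (mid (p , i))))) ∎)
    where
    open ≡-Reasoning
    R-candidates : List R.Carrier
    R-candidates = concatMap (λ p → map (p ,_) (allFin n)) (allFin size)
    regroup : ∀ z → guard (inR? z ∧ belowT? z ∧ halfOpen (dual Î) htop y (mid z)) (h (mid z)) ≡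
                    guard (inR? z) (guard (belowT? z) (guard (halfOpen (dual Î) htop y (mid z)) (h (mid z))))
    regroup z = trans (guard-∧ (inR? z) _ _) (cong (guard (inR? z)) (guard-∧ (belowT? z) _ _))

  φ : Î.Carrier → Q.Carrier
  φ hbot          = (bot , w)
  φ htop          = m₀
  φ (mid (p , i)) = (p , take (lengthOf (toℕ i)) w)

  -- The elements of Î other than 0̂; μ is transported along φ on them.
  data AboveBottom : Î.Carrier → Set where
    at-top : AboveBottom htop
    at-mid : ∀ {q i'} → InteriorPoint q i' → AboveBottom (mid (q , i'))

  interiorPoint : ∀ {q i'} → inR? (q , i') ≡ true → belowT? (q , i') ≡ true → InteriorPoint q i'
  interiorPoint {q} {i'} inR-q belowT-q = record
    { inR    = refutation (q FinP.≟ bot) (not-true (proj₁ (∧-true inR-q))) ,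
               witness (toℕ i' ℕP.≤? rkMinus q) (proj₂ (∧-true inR-q))
    ; belowT = witness ((q , i') R.≼? T) (proj₁ (∧-true belowT-q)) ,
               refutation ((q , i') R.≟ T) (not-true (proj₂ (∧-true belowT-q))) }
    where
    not-true : ∀ {b} → not b ≡ true → b ≡ false
    not-true {false} _ = refl

  upper-interior : ∀ {q i'} (y : InteriorPoint q i') p i →
    inUpper (mid (q , i')) p i ≡ does ((toℕ i ℕP.<? k) ×-dec Between? q (InteriorPoint.ℓ' y) p (lengthOf (toℕ i)))
  upper-interior {q} {i'} y p i = does-iff (Upper? (mid (q , i')) p i)
                                    ((toℕ i ℕP.<? k) ×-dec Between? q (InteriorPoint.ℓ' y) p (lengthOf (toℕ i))) (to (upper-interior⇔ q i' y p i))
                                                                         (from (upper-interior⇔ q i' y p i))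

  upper-bot : ∀ p i → inUpper hbot p i ≡ does ((toℕ i ℕP.<? k) ×-dec Between? bot k p (lengthOf (toℕ i)))
  upper-bot p i = does-iff (Upper? hbot p i) ((toℕ i ℕP.<? k) ×-dec Between? bot k p (lengthOf (toℕ i))) (to (upper-bot⇔ p i)) (from (upper-bot⇔ p i))

  prefix-short : ∀ q ℓ' → ℓ' < k → (g : Q.Carrier → ℤ) → ∀ p ℓ → let u = take ℓ' w in
    guard (does (ℓ ℕP.≤? length u)) (guard (inQ? (p , take ℓ u) ∧ halfOpen Q m₀ (q , u) (p , take ℓ u)) (g (p , take ℓ u)))
    ≡ guard (inShortInterval q ℓ' p ℓ) (g (p , take ℓ w))
  prefix-short q ℓ' ℓ'<k g p ℓ = byCases (ℓ ℕP.≤? ℓ')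
    where
    open ≡-Reasoning
    u = take ℓ' w
    |u| : length u ≡ ℓ'
    |u| = length-take (ℕP.<⇒≤ ℓ'<k)
    term : Word → ℤ
    term v = guard (inQ? (p , v) ∧ halfOpen Q m₀ (q , u) (p , v)) (g (p , v))
    test : Bool
    test = inQ? (p , take ℓ w) ∧ halfOpen Q m₀ (q , u) (p , take ℓ w)
    byCases : Dec (ℓ ≤ ℓ') → guard (does (ℓ ℕP.≤? length u)) (term (take ℓ u)) ≡ guard (inShortInterval q ℓ' p ℓ) (g (p , take ℓ w))
    byCases (yes ℓ≤ℓ') = begin
      guard (does (ℓ ℕP.≤? length u)) (term (take ℓ u))
        ≡⟨ cong (λ b → guard b (term (take ℓ u))) (dec-true (ℓ ℕP.≤? length u) (subst (ℓ ≤_) (sym |u|) ℓ≤ℓ')) ⟩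
      term (take ℓ u)
        ≡⟨ cong term (take-shorter w ℓ≤ℓ') ⟩
      guard (true ∧ true ∧ test) (g (p , take ℓ w))
        ≡⟨ cong₂ (λ a b → guard (a ∧ b ∧ test) (g (p , take ℓ w)))
                 (sym (dec-true (ℓ ℕP.<? k) (ℕP.≤-<-trans ℓ≤ℓ' ℓ'<k))) (sym (dec-true (ℓ ℕP.≤? ℓ') ℓ≤ℓ')) ⟩
      guard (inShortInterval q ℓ' p ℓ) (g (p , take ℓ w)) ∎
    byCases (no ℓ≰ℓ') = begin
      guard (does (ℓ ℕP.≤? length u)) (term (take ℓ u))
        ≡⟨ cong (λ b → guard b (term (take ℓ u))) (dec-false (ℓ ℕP.≤? length u) (λ ℓ≤ → ℓ≰ℓ' (subst (ℓ ≤_) |u| ℓ≤))) ⟩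
      + 0
        ≡⟨ sym (vanishes (does (ℓ ℕP.<? k))) ⟩
      guard (does (ℓ ℕP.<? k) ∧ false ∧ test) (g (p , take ℓ w))
        ≡⟨ cong (λ b → guard (does (ℓ ℕP.<? k) ∧ b ∧ test) (g (p , take ℓ w))) (sym (dec-false (ℓ ℕP.≤? ℓ') ℓ≰ℓ')) ⟩
      guard (inShortInterval q ℓ' p ℓ) (g (p , take ℓ w)) ∎
      where
      vanishes : ∀ a → guard (a ∧ false ∧ test) (g (p , take ℓ w)) ≡ + 0
      vanishes true  = refl
      vanishes false = refl

  φ-≟ : ∀ y → AboveBottom y → does (φ htop Q.≟ φ y) ≡ does (FinOrd._≟_ (dual Î) htop y)
  φ-≟ .htop at-top = dec-true (m₀ Q.≟ m₀) refl
  φ-≟ .(mid (q , i')) (at-mid {q} {i'} y) = dec-false (m₀ Q.≟ (q , take ℓ' w))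
    (λ e → notBase (sym (cong proj₁ e) , trans (sym (length-take ℓ'≤k)) (sym (cong (λ z → length (proj₂ z)) e))))
    where
    open InteriorPoint y
    open Anchor anchor

  φ-≼ : ∀ y → AboveBottom y → does (φ htop Q.≼? φ y) ≡ does (FinOrd._≼?_ (dual Î) htop y)
  φ-≼ .htop at-top = dec-true (m₀ Q.≼? m₀) (IsPartialOrder.refl Q-isPartialOrder)
  φ-≼ .(mid (q , i')) (at-mid {q} {i'} y) = dec-true (m₀ Q.≼? (q , take ℓ' w))
    (m₀≼ q (take ℓ' w) (subst (λ a → a + rk q ≤ n) (sym (length-take ℓ'≤k)) ≤n))
    where
    open InteriorPoint y
    open Anchor anchor

  φ-halfOpen : ∀ y → AboveBottom y → FinOrd._≼_ (dual Î) htop y → ¬ htop ≡ y → (g : Q.Carrier → ℤ) →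
    sumWhere (halfOpen Q (φ htop) (φ y)) g Q.elems ≡ sumWhere (halfOpen (dual Î) htop y) (λ z → g (φ z)) Î.elems
  φ-halfOpen .htop at-top _ htop≢htop g = contradiction refl htop≢htop
  φ-halfOpen .(mid (q , i')) (at-mid {q} {i'} y) _ _ g = begin
    sumWhere (halfOpen Q m₀ (q , take ℓ' w)) g Q.elems
      ≡⟨ trans (halfOpenSum q (take ℓ' w) g)
               (sumOver-cong (allFin size) (λ p → sumOver-cong (upTo (suc n)) (prefix-short q ℓ' (lengthOf<k a') g p))) ⟩
    sumOver (allFin size) (λ p → sumOver (upTo (suc n)) (λ ℓ → guard (inShortInterval q ℓ' p ℓ) (g (p , take ℓ w))))
      ≡⟨ trans (shortIntervalSum q ℓ' anchor (inUpper (mid (q , i'))) (upper-interior y) (λ p ℓ → g (p , take ℓ w)))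
               (sym (upperSum (mid (q , i')) (λ z → g (φ z)) refl refl)) ⟩
    sumWhere (halfOpen (dual Î) htop (mid (q , i'))) (λ z → g (φ z)) Î.elems ∎
    where
    open ≡-Reasoning
    open InteriorPoint y

  aboveBottom-closed : ∀ y z → AboveBottom y → z ∈ Î.elems → halfOpen (dual Î) htop y z ≡ true → AboveBottom z
  aboveBottom-closed y .hbot r (here refl) e with witness (y Î.≼? hbot) (proj₁ (∧-true {does (y Î.≼? hbot)} e))
  aboveBottom-closed .htop _ at-top     (here refl) e | ()
  aboveBottom-closed .(mid _) _ (at-mid _) (here refl) e | ()
  aboveBottom-closed y .htop r (there (here refl)) e = at-top
  aboveBottom-closed y z r (there (there z∈)) e with ∈-map⁻ mid z∈
  ... | ((q , i') , z∈I , refl) =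
    let (belowT-q , z∈R) = filterB-∈ belowT? {xs = R.elems} z∈I
        (inR-q , _) = filterB-∈ inR? {xs = concatMap (λ p → map (p ,_) (allFin n)) (allFin size)} z∈R
    in at-mid (interiorPoint inR-q belowT-q)

  module Toφ = Transport (dual Î) Q φ htop AboveBottom φ-≟ φ-≼ φ-halfOpen aboveBottom-closed

  htop∈Î : htop ∈ Î.elems
  htop∈Î = there (here refl)

  μ-transport : ∀ y → AboveBottom y → Î*.μ htop y ≡ μQ m₀ (φ y)
  μ-transport y r = begin
    Î*.μ htop y                    ≡⟨ Î*.möbiusFuel-stable htop htop∈Î (length Î.elems) K y (Î*.height-bounded y)
                                        (ℕP.≤-trans (Î*.height-bounded y) (ℕP.m≤m+n _ _)) ⟩
    möbiusFuel (dual Î) K htop y    ≡⟨ Toφ.transport K y r ⟩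
    möbiusFuel Q K m₀ (φ y)         ≡⟨ Qμ.μ-fuel m₀ m₀∈Q K (φ y) (ℕP.≤-trans (Qμ.height-bounded (φ y)) (ℕP.m≤n+m _ _)) ⟩
    μQ m₀ (φ y)                    ∎
    where
    open ≡-Reasoning
    K = length Î.elems + length Q.elems

  μPrefix : Fin size → ℕ → ℤ
  μPrefix p ℓ = μQ m₀ (p , take ℓ w)

  interiorSum : ℤ
  interiorSum = sumOver (allFin size) (λ p → sumOver (allFin n) (λ i →
                  guard (inUpper hbot p i) (μPrefix p (lengthOf (toℕ i)))))

  -- μ(Î_j(P)), through μ_{Î*}(1̂, 0̂) and its recursion, in terms of μ_Q.
  μÎ : μHat (idealI j) ≡ - (+ 1 ⊕ interiorSum)
  μÎ = begin
    μHat (idealI j)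
      ≡⟨ ÎDuality.μ≡μ* hbot htop (here refl) htop∈Î ⟩
    Î*.μ htop hbot
      ≡⟨ Î*.μ-recursion htop hbot htop∈Î (here refl) bot≤ (λ ()) ⟩
    - sumWhere (halfOpen (dual Î) htop hbot) (Î*.μ htop) Î.elems
      ≡⟨ cong -_ (upperSum hbot (Î*.μ htop) refl refl) ⟩
    - (Î*.μ htop htop ⊕ sumOver (allFin size) (λ p → sumOver (allFin n) (λ i → guard (inUpper hbot p i) (Î*.μ htop (mid (p , i))))))
      ≡⟨ cong -_ (cong₂ _⊕_ (Î*.μ-refl htop)
                            (sumOver-cong (allFin size) (λ p → sumOver-cong (allFin n) (λ i → transported p i)))) ⟩
    - (+ 1 ⊕ interiorSum) ∎
    where
    open ≡-Reasoning
    transported : ∀ p i → guard (inUpper hbot p i) (Î*.μ htop (mid (p , i))) ≡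
                          guard (inUpper hbot p i) (μPrefix p (lengthOf (toℕ i)))
    transported p i with inUpper hbot p i in e
    ... | false = refl
    ... | true  = let (inR-p , rest) = ∧-true e in
                  μ-transport (mid (p , i)) (at-mid (interiorPoint inR-p (proj₁ (∧-true rest))))

  -- The short part of [m₀, (0̂, w)) is m₀ together with the image of (0̂, 1̂).
  shorterSum≡-μÎ : shorterSum w ≡ - μHat (idealI j)
  shorterSum≡-μÎ = begin
    shorterSum w
      ≡⟨ sumOver-cong (allFin size) (λ p → sumOver-cong (upTo (suc n)) (as-short p)) ⟩
    sumOver (allFin size) (λ p → sumOver (upTo (suc n)) (λ ℓ → guard (inShortInterval bot k p ℓ) (μPrefix p ℓ)))
      ≡⟨ shortIntervalSum bot k anchor-bot (inUpper hbot) upper-bot μPrefix ⟩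
    μQ m₀ m₀ ⊕ interiorSum
      ≡⟨ cong (_⊕ interiorSum) (Qμ.μ-refl m₀) ⟩
    + 1 ⊕ interiorSum
      ≡⟨ sym (ℤP.neg-involutive _) ⟩
    - - (+ 1 ⊕ interiorSum)
      ≡⟨ cong -_ (sym μÎ) ⟩
    - μHat (idealI j) ∎
    where
    open ≡-Reasoning
    w↾k : take k w ≡ w
    w↾k = ListP.take-all k w (ℕP.≤-reflexive |w|≡k)
    shorter : ∀ ℓ (c : Bool) (v : ℤ) (d : Dec (ℓ < k)) → guard (does d) (guard c v) ≡ guard (does d ∧ does (ℓ ℕP.≤? k) ∧ c) v
    shorter ℓ c v (yes ℓ<k) = sym (cong (λ b → guard (b ∧ c) v) (dec-true (ℓ ℕP.≤? k) (ℕP.<⇒≤ ℓ<k)))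
    shorter ℓ c v (no _)    = refl
    as-short : ∀ p ℓ →
      guard (does (ℓ ℕP.<? length w)) (guard (inQ? (p , take ℓ w) ∧ halfOpen Q m₀ (bot , w) (p , take ℓ w)) (μPrefix p ℓ))
      ≡ guard (inShortInterval bot k p ℓ) (μPrefix p ℓ)
    as-short p ℓ = begin
      guard (does (ℓ ℕP.<? length w)) (guard (inQ? (p , take ℓ w) ∧ halfOpen Q m₀ (bot , w) (p , take ℓ w)) (μPrefix p ℓ))
        ≡⟨ cong (λ m → guard (does (ℓ ℕP.<? m))
                             (guard (inQ? (p , take ℓ w) ∧ halfOpen Q m₀ (bot , w) (p , take ℓ w)) (μPrefix p ℓ))) |w|≡k ⟩
      guard (does (ℓ ℕP.<? k)) (guard (inQ? (p , take ℓ w) ∧ halfOpen Q m₀ (bot , w) (p , take ℓ w)) (μPrefix p ℓ))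
        ≡⟨ shorter ℓ (inQ? (p , take ℓ w) ∧ halfOpen Q m₀ (bot , w) (p , take ℓ w)) (μPrefix p ℓ) (ℓ ℕP.<? k) ⟩
      guard (does (ℓ ℕP.<? k) ∧ does (ℓ ℕP.≤? k) ∧ inQ? (p , take ℓ w) ∧ halfOpen Q m₀ (bot , w) (p , take ℓ w)) (μPrefix p ℓ)
        ≡⟨ cong (λ u → guard (does (ℓ ℕP.<? k) ∧ does (ℓ ℕP.≤? k) ∧ inQ? (p , take ℓ w) ∧ halfOpen Q m₀ (bot , u) (p , take ℓ w))
                         (μPrefix p ℓ)) (sym w↾k) ⟩
      guard (inShortInterval bot k p ℓ) (μPrefix p ℓ) ∎

module Assembly (P : BoundedRankedPoset) (t : ℕ) (1≤n : 1 ≤ BoundedRankedPoset.len P) where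

  open import Data.Nat using (zero; _^_; s≤s)
  import Data.Nat.Properties as ℕP
  import Data.Fin.Properties as FinP
  open import Data.Integer using (+_; _*_) renaming (_+_ to _⊕_)
  import Data.Integer as ℤ
  import Data.Integer.Properties as ℤP
  open import Data.List using (allFin; upTo; applyUpTo)
  open import Data.List.Membership.Propositional.Properties using (∈-upTo⁺; ∈-concatMap⁺)
  import Data.List.Relation.Unary.Any as Any
  import Data.List.Relation.Unary.All as All
  open import Data.Bool using (true)
  open import Function using (_∘_)
  open import Relation.Nullary using (does; ¬_)
  open import Relation.Binary.PropositionalEquality using (refl; cong; sym; trans; module ≡-Reasoning)
  open BoundedRankedPoset P
  open Constructions P
  open TreeWords P t
  open ReesTree P t
  open FiniteSums
  open SegmentSums

  top≢bot : ¬ top ≡ bot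
  top≢bot e = ℕP.<⇒≱ 1≤n (ℕP.≤-reflexive (trans (cong rk e) rk-bot))

  levelSum-suc : ∀ (j : Fin n) → levelSum (suc (toℕ j)) ≡ + (t ^ suc (toℕ j)) * μHat (idealI j)
  levelSum-suc j = trans (sumOver-cong-∈ wordSum≡μÎ) (words-count (suc (toℕ j)) (μHat (idealI j)))
    where
    k≤n = FinP.toℕ<n j
    wordSum≡μÎ : ∀ w → w ∈ words (suc (toℕ j)) → wordSum w ≡ μHat (idealI j)
    wordSum≡μÎ w w∈ = begin
      wordSum w                ≡⟨ wordSum≡-shorterSum w w∈T (ℕP.≤-trans (ℕP.≤-reflexive |w|≡k) k≤n) top≢bot ⟩
      - shorterSum w           ≡⟨ cong -_ (ShorterWords.shorterSum≡-μÎ P t 1≤n j w |w|≡k w∈T) ⟩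
      - - μHat (idealI j)      ≡⟨ ℤP.neg-involutive _ ⟩
      μHat (idealI j)          ∎
      where
      open ≡-Reasoning
      |w|≡k = All.lookup (words-length (suc (toℕ j))) w∈
      w∈T = ∈-concatMap⁺ words (Any.map (λ { refl → w∈ }) (∈-upTo⁺ (s≤s k≤n)))

  pos-^ : ∀ m → (+ t) ℤ.^ m ≡ + (t ^ m)
  pos-^ zero    = refl
  pos-^ (suc m) = trans (cong ((+ t) *_) (pos-^ m)) (sym (ℤP.pos-* t (t ^ m)))

  main : lhsSum t ≡ - μReesPlus t
  main = begin
    lhsSum t
      ≡⟨ sumWhere≡sumOver (λ _ → true) _ (allFin n) ⟩
    sumOver (allFin n) (λ j → μHat (idealI j) * (+ t) ℤ.^ suc (toℕ j))
      ≡⟨ sumOver-cong (allFin n) (λ j → trans (ℤP.*-comm (μHat (idealI j)) _)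
                                       (trans (cong (_* μHat (idealI j)) (pos-^ (suc (toℕ j)))) (sym (levelSum-suc j)))) ⟩
    sumOver (allFin n) (levelSum ∘ suc ∘ toℕ)
      ≡⟨ trans (Σ<-allFin n (levelSum ∘ suc)) (sym (Σ<-applyUpTo n suc levelSum)) ⟩
    sumOver (applyUpTo suc n) levelSum
      ≡⟨ sym (trans (cong (_⊕ sumOver (applyUpTo suc n) levelSum) (levelSum-zero top≢bot)) (ℤP.+-identityˡ _)) ⟩
    sumOver (upTo (suc n)) levelSum
      ≡⟨ sym sum-by-levels ⟩
    sumOver Q.elems (λ z → guard (does (m₀ Q.≼? z)) (μQ m₀ z))
      ≡⟨ sym (ℤP.neg-involutive _) ⟩
    - - sumOver Q.elems (λ z → guard (does (m₀ Q.≼? z)) (μQ m₀ z))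
      ≡⟨ cong -_ (sym μ-plus) ⟩
    - μReesPlus t ∎
    where open ≡-Reasoning

theorem4p1 : (P : BoundedRankedPoset) (t : ℕ) → 1 ≤ t →
             1 ≤ BoundedRankedPoset.len P →
             Constructions.lhsSum P t ≡ - Constructions.μReesPlus P t
theorem4p1 P t _ 1≤n = Assembly.main P t 1≤n
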